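{- Let $r\geq 3$. Let $\mathcal{G}^{(r)}$ be the edge-labelled graph with two connected components: the first is a path on vertices $1,2,\dots,r+2$ with edges $\{j,j+1\}$ of label $j-1$ for $j=1,\dots,r$ and an edge $\{r+1,r+2\}$ of label $r-2$; the second is a path on vertices $w_1,\dots,w_r$ with edges $\{w_j,w_{j+1}\}$ of label $j-1$ for $j=1,\dots,r-1$. Then $\mathcal{G}^{(r)}$ is a CPR graph and the group it represents is isomorphic to $S_{r+2}\times S_r$.
   Context: A string C-group of rank $r$ is a group $G$ with an ordered sequence $(\rho_0,\dots,\rho_{r-1})$ of involutions generating $G$ such that $(\rho_i\rho_j)^2=1$ whenever $|i-j|\geq2$ and $\langle \rho_i : i\in I\rangle\cap\langle\rho_j : j\in J\rangle=\langle \rho_k : k\in I\cap J\rangle$ for all $I,J\subseteq\{0,\dots,r-1\}$. An edge-labelled multigraph on a finite set $\Omega$ with labels $0,\dots,r-1$, in which each vertex lies on at most one edge of each label and each label occurs, determines involutions $\rho_l\in\mathrm{Sym}(\Omega)$, $\rho_l$ being the product of the transpositions $(a\,b)$ over the edges $\{a,b\}$ of label $l$; the group it represents is $\langle\rho_0,\dots,\rho_{r-1}\rangle$, and the graph is a CPR graph if this group with generating sequence $(\rho_0,\dots,\rho_{r-1})$ is a string C-group. -}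

module Defs where

open import Level using (0ℓ)
open import Data.Nat using (ℕ; zero; suc; _≤_; _<_; _∸_; ∣_-_∣)
open import Data.Nat.Properties using () renaming (_≟_ to _≟ℕ_)
open import Data.Fin using (Fin; toℕ; fromℕ; inject₁) renaming (zero to fzero; suc to fsuc)
open import Data.Fin.Subset using (Subset; _∈_; _∩_; ⊤)
open import Data.Fin.Permutation using (Permutation′; _⟨$⟩ʳ_; _∘ₚ_; flip) renaming (id to idₚ)
open import Data.List using (List; []; _∷_; map; foldr; _++_; reverse)
open import Data.List.Relation.Unary.All using (All)
open import Data.List.Membership.Propositional using () renaming (_∈_ to _∈ₗ_)
open import Data.Product using (Σ; ∃; _×_; _,_; proj₁; proj₂)
open import Data.Sum using (_⊎_; inj₁; inj₂)
open import Function using (_∘_; id)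
open import Relation.Nullary using (¬_; yes; no)
open import Relation.Binary.Definitions using (DecidableEquality)
open import Relation.Binary.PropositionalEquality using (_≡_; _≢_)
open import Algebra.Bundles.Raw using (RawGroup)
import Algebra.Construct.DirectProduct as DP
open import Algebra.Morphism.Structures using (module GroupMorphisms)

-- Edge-labelled multigraphs on a vertex set Ω, labels are natural numbers.
-- An edge is a triple (label , a , b) standing for the edge {a,b}.

Edge : Set → Set
Edge Ω = ℕ × Ω × Ω

module Graph {Ω : Set} (_≟_ : DecidableEquality Ω) (E : List (Edge Ω)) where

  -- ρ l : the involution determined by the edges of label l, i.e. the
  -- product of the transpositions (a b) over the edges {a,b} of label l
  -- (under the well-formedness condition below these transpositions are
  -- disjoint, so this is x ↦ the other endpoint of the l-edge at x, or x).
  ρ : ℕ → Ω → Ω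
  ρ l x = go E
    where
    go : List (Edge Ω) → Ω
    go [] = x
    go ((l' , a , b) ∷ es) with l ≟ℕ l'
    ... | no _ = go es
    ... | yes _ with x ≟ a
    ...   | yes _ = b
    ...   | no _ with x ≟ b
    ...     | yes _ = a
    ...     | no _ = go es

  WellFormed : ℕ → Set
  WellFormed r =
      (∀ {l a b} → (l , a , b) ∈ₗ E → (l < r) × (a ≢ b))
    × (∀ {l a b c d} → (l , a , b) ∈ₗ E → (l , c , d) ∈ₗ E →
         (a ≡ c ⊎ a ≡ d ⊎ b ≡ c ⊎ b ≡ d) → (a ≡ c × b ≡ d) ⊎ (a ≡ d × b ≡ c))
    × (∀ (l : Fin r) → ∃ λ a → ∃ λ b → (toℕ l , a , b) ∈ₗ E)

-- An element of ⟨ρ_i : i ∈ I⟩ is represented by a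
-- word in the generators indexed by I; two words are equal in the group
-- iff they evaluate to the same function on Ω.

module Generated {Ω : Set} {r : ℕ} (ρ : Fin r → Ω → Ω) where

  Word : Set
  Word = List (Fin r)

  eval : Word → Ω → Ω
  eval = foldr (λ i f → ρ i ∘ f) id

  _≗_ : (Ω → Ω) → (Ω → Ω) → Set
  f ≗ g = ∀ x → f x ≡ g x

  InGen : Subset r → (Ω → Ω) → Set
  InGen I σ = Σ Word λ w → All (_∈ I) w × (eval w ≗ σ)

  IsInvolution : (Ω → Ω) → Set
  IsInvolution f = ((f ∘ f) ≗ id) × (∃ λ x → f x ≢ x)

  IsStringCGroup : Set
  IsStringCGroup =
      (∀ i → IsInvolution (ρ i))
    × (∀ i j → 2 ≤ ∣ toℕ i - toℕ j ∣ → (ρ i ∘ ρ j ∘ ρ i ∘ ρ j) ≗ id)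
    × (∀ (I J : Subset r) (σ : Ω → Ω) →
         (InGen I σ × InGen J σ → InGen (I ∩ J) σ)
       × (InGen (I ∩ J) σ → InGen I σ × InGen J σ))

  -- The group G = ⟨ρ₀,…,ρ_{r-1}⟩ as a (raw) group: words modulo equality
  -- of their evaluations, multiplication = concatenation (i.e. composition),
  -- inverse = reversal (valid since the ρ_i are involutions).
  groupRaw : RawGroup 0ℓ 0ℓ
  groupRaw = record
    { Carrier = Word
    ; _≈_ = λ w v → eval w ≗ eval v
    ; _∙_ = _++_
    ; ε = []
    ; _⁻¹ = reverse
    }

-- The symmetric group S_n on Fin n (multiplication = composition of maps,
-- (π · σ)(x) = π(σ(x))), and isomorphism of groups.

Sym : ℕ → RawGroup 0ℓ 0ℓ
Sym n = record
  { Carrier = Permutation′ n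
  ; _≈_ = λ π σ → ∀ i → π ⟨$⟩ʳ i ≡ σ ⟨$⟩ʳ i
  ; _∙_ = λ π σ → σ ∘ₚ π
  ; ε = idₚ
  ; _⁻¹ = flip
  }

_×G_ : RawGroup 0ℓ 0ℓ → RawGroup 0ℓ 0ℓ → RawGroup 0ℓ 0ℓ
G ×G H = DP.rawGroup G H

_≅_ : RawGroup 0ℓ 0ℓ → RawGroup 0ℓ 0ℓ → Set
G ≅ H = Σ (RawGroup.Carrier G → RawGroup.Carrier H)
          (GroupMorphisms.IsGroupIsomorphism G H)

module _ {Ω : Set} (_≟_ : DecidableEquality Ω) (r : ℕ) (E : List (Edge Ω)) where
  open Graph _≟_ E

  ρs : Fin r → Ω → Ω
  ρs i = ρ (toℕ i)

  IsCPRGraph : Set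
  IsCPRGraph = WellFormed r × Generated.IsStringCGroup ρs

  RepGroup : RawGroup 0ℓ 0ℓ
  RepGroup = Generated.groupRaw ρs

pathEdges : (n : ℕ) → List (Edge (Fin n))
pathEdges zero = []
pathEdges (suc zero) = []
pathEdges (suc (suc n)) =
  (0 , fzero , fsuc fzero) ∷ map shift (pathEdges (suc n))
  where
  shift : Edge (Fin (suc n)) → Edge (Fin (suc (suc n)))
  shift (l , a , b) = (suc l , fsuc a , fsuc b)

-- Vertex set: first component Fin (r+2) (vertex j ↦ j-1),
-- second component Fin r (vertex w_j ↦ j-1).
Vtx : ℕ → Set
Vtx r = Fin (suc (suc r)) ⊎ Fin r

vtx-≟ : (r : ℕ) → DecidableEquality (Vtx r)
vtx-≟ r = Data.Sum.Properties.≡-dec Data.Fin._≟_ Data.Fin._≟_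
  where import Data.Sum.Properties; import Data.Fin

mapEdge : {A B : Set} → (A → B) → Edge A → Edge B
mapEdge f (l , a , b) = (l , f a , f b)

𝒢 : (r : ℕ) → List (Edge (Vtx r))
𝒢 r =
     map (mapEdge (inj₁ ∘ inject₁)) (pathEdges (suc r))
     -- edges {j,j+1} of label j-1, j = 1,…,r
  ++ ((r ∸ 2 , inj₁ (inject₁ (fromℕ r)) , inj₁ (fromℕ (suc r))) ∷ [])
     -- edge {r+1,r+2} of label r-2
  ++ map (mapEdge inj₂) (pathEdges r)
     -- edges {w_j,w_{j+1}} of label j-1, j = 1,…,r-1

-- Write r = q + 3 and number the two components of 𝒢 r as A = {0, …, q + 4} and B = {0, …, q + 2}.
-- Every ρ_l acts on A and on B as the adjacent transposition (l l+1), except that ρ_{q+1} also swaps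
-- q + 3 and q + 4 on A and ρ_{q+2} is trivial on B, so the group embeds in S_{q+5} × S_{q+3}.
-- The proof rests on a description of the subgroups ⟨ρ_j : j ≢ k⟩ (Parabolic): their elements (α, β)
-- preserve {0, …, k} and agree there, and for k = q, resp. k = q + 1, they also respect the dihedral
-- symmetry of {q + 1, …, q + 4}, resp. fix q + 4. Every ρ_j with j ≢ k preserves these conditions.
-- Conversely, a pair satisfying them for all k outside a set P of labels is a word in {ρ_j : j ∈ P}:
-- sort β by bubble sort, which only uses the adjacent transpositions it must, then produce what is
-- left of α by words acting trivially on B, obtained by conjugating ρ_{q+2} and (ρ_{q+1} ρ_q)³.
-- With P = everything this gives surjectivity onto S_{r+2} × S_r; with P = I ∩ J it gives the
-- intersection property, since an element of ⟨ρ_i : i ∈ I⟩ ∩ ⟨ρ_j : j ∈ J⟩ satisfies the conditions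
-- for every k outside I and for every k outside J.

module Submission where

open import Defs
open import Algebra.Bundles.Raw using (RawGroup)
open import Algebra.Morphism.Structures using (module GroupMorphisms)
open import Data.Empty using (⊥-elim)
open import Data.Fin as Fin using (Fin; toℕ; fromℕ; fromℕ<; inject₁)
open import Data.Fin.Properties using (toℕ-injective; toℕ<n; toℕ-fromℕ<; fromℕ<-toℕ; toℕ-fromℕ; toℕ-inject₁)
open import Data.Fin.Permutation as Perm using (Permutation′; permutation; _⟨$⟩ʳ_; _⟨$⟩ˡ_)
open import Data.Fin.Subset using (Subset; _∩_) renaming (_∈_ to _∈ₛ_)
open import Data.Fin.Subset.Properties using (x∈p∩q⁺; p∩q⊆p; p∩q⊆q; _∈?_)
open import Data.List using (List; []; _∷_; _++_; map; reverse)
open import Data.List.Properties using (unfold-reverse; reverse-involutive; reverse-map)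
open import Data.List.Membership.Propositional using (_∈_)
open import Data.List.Membership.Propositional.Properties using (∈-map⁻; ∈-map⁺; ∈-++⁻; ∈-++⁺ˡ; ∈-++⁺ʳ)
open import Data.List.Relation.Unary.All as All using (All; []; _∷_)
open import Data.List.Relation.Unary.All.Properties using (++⁺; map⁺)
open import Data.List.Relation.Unary.Any using (here; there)
open import Data.List.Relation.Binary.Permutation.Propositional using (↭-sym)
open import Data.List.Relation.Binary.Permutation.Propositional.Properties using (All-resp-↭; ↭-reverse)
open import Data.Nat
open import Data.Nat.Properties
open import Data.Product using (Σ-syntax; ∃; ∃₂; _×_; _,_; proj₁; proj₂)
open import Data.Sum using (_⊎_; inj₁; inj₂)
open import Data.Sum.Properties using (inj₁-injective; inj₂-injective)
open import Data.Unit using (⊤; tt)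
open import Function using (_∘_; id)
open import Relation.Nullary using (¬_; yes; no; contradiction)
open import Relation.Nullary.Decidable using (True; False; toWitness; toWitnessFalse)
open import Relation.Unary using (Decidable)
open import Relation.Binary.Definitions using (DecidableEquality; tri<; tri≈; tri>)
open import Relation.Binary.PropositionalEquality
open import Algebra.Definitions {A = ℕ} _≡_ using (Involutive)
open ≡-Reasoning

-- Transpositions and involutions of ℕ

opaque
  transpose : ℕ → ℕ → ℕ → ℕ
  transpose a b n with n ≟ a | n ≟ b
  ... | yes _ | _     = b
  ... | no _  | yes _ = a
  ... | no _  | no _  = n

  transpose-matchˡ : ∀ a b → transpose a b a ≡ b
  transpose-matchˡ a b with a ≟ a | a ≟ b
  ... | yes _   | _ = refl
  ... | no a≢a  | _ = ⊥-elim (a≢a refl)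

  transpose-matchʳ : ∀ a b → transpose a b b ≡ a
  transpose-matchʳ a b with b ≟ a | b ≟ b
  ... | yes b≡a | _       = b≡a
  ... | no _    | yes _   = refl
  ... | no _    | no b≢b  = ⊥-elim (b≢b refl)

  transpose-mismatch : ∀ {a b n} → n ≢ a → n ≢ b → transpose a b n ≡ n
  transpose-mismatch {a} {b} {n} n≢a n≢b with n ≟ a | n ≟ b
  ... | yes n≡a | _       = ⊥-elim (n≢a n≡a)
  ... | no _    | yes n≡b = ⊥-elim (n≢b n≡b)
  ... | no _    | no _    = refl

data TransposeView (a b n : ℕ) : Set where
  at-a  : n ≡ a → TransposeView a b n
  at-b  : n ≡ b → TransposeView a b n
  other : n ≢ a → n ≢ b → TransposeView a b n

transposeView : ∀ a b n → TransposeView a b n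
transposeView a b n with n ≟ a | n ≟ b
... | yes n≡a | _       = at-a n≡a
... | no _    | yes n≡b = at-b n≡b
... | no n≢a  | no n≢b  = other n≢a n≢b

transpose-involutive : ∀ a b → Involutive (transpose a b)
transpose-involutive a b n with transposeView a b n
... | at-a refl = trans (cong (transpose n b) (transpose-matchˡ n b)) (transpose-matchʳ n b)
... | at-b refl = trans (cong (transpose a n) (transpose-matchʳ a n)) (transpose-matchˡ a n)
... | other n≢a n≢b =
  trans (cong (transpose a b) (transpose-mismatch n≢a n≢b)) (transpose-mismatch n≢a n≢b)

transpose-sym : ∀ a b n → transpose a b n ≡ transpose b a n
transpose-sym a b n with transposeView a b n
... | at-a refl = trans (transpose-matchˡ n b) (sym (transpose-matchʳ b n))
... | at-b refl = trans (transpose-matchʳ a n) (sym (transpose-matchˡ n a))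
... | other n≢a n≢b = trans (transpose-mismatch n≢a n≢b) (sym (transpose-mismatch n≢b n≢a))

transpose-natural : ∀ f → (∀ {x y} → f x ≡ f y → x ≡ y) →
                    ∀ a b n → f (transpose a b n) ≡ transpose (f a) (f b) (f n)
transpose-natural f f-inj a b n with transposeView a b n
... | at-a refl = trans (cong f (transpose-matchˡ n b)) (sym (transpose-matchˡ (f n) (f b)))
... | at-b refl = trans (cong f (transpose-matchʳ a n)) (sym (transpose-matchʳ (f a) (f n)))
... | other n≢a n≢b = trans (cong f (transpose-mismatch n≢a n≢b))
                            (sym (transpose-mismatch (n≢a ∘ f-inj) (n≢b ∘ f-inj)))

involutive⇒injective : ∀ {f} → Involutive f → ∀ {x y} → f x ≡ f y → x ≡ y
involutive⇒injective {f} f-inv {x} {y} fx≡fy =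
  trans (sym (f-inv x)) (trans (cong f fx≡fy) (f-inv y))

transpose-conjugate : ∀ f → Involutive f →
                      ∀ a b n → f (transpose a b (f n)) ≡ transpose (f a) (f b) n
transpose-conjugate f f-inv a b n =
  trans (transpose-natural f (involutive⇒injective f-inv) a b (f n))
        (cong (transpose (f a) (f b)) (f-inv n))

transpose-< : ∀ {a b n N} → a < N → b < N → n < N → transpose a b n < N
transpose-< {a} {b} {n} a<N b<N n<N with transposeView a b n
... | at-a refl = subst (_< _) (sym (transpose-matchˡ n b)) b<N
... | at-b refl = subst (_< _) (sym (transpose-matchʳ a n)) a<N
... | other n≢a n≢b = subst (_< _) (sym (transpose-mismatch n≢a n≢b)) n<N

transpose-moves : ∀ {a b n} → transpose a b n ≢ n → n ≡ a ⊎ n ≡ b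
transpose-moves {a} {b} {n} moved with transposeView a b n
... | at-a n≡a = inj₁ n≡a
... | at-b n≡b = inj₂ n≡b
... | other n≢a n≢b = ⊥-elim (moved (transpose-mismatch n≢a n≢b))

disjoint-involutions-commute : ∀ f g → Involutive f → Involutive g →
  (∀ n → f n ≢ n → g n ≡ n) → (∀ n → g n ≢ n → f n ≡ n) → ∀ n → f (g n) ≡ g (f n)
disjoint-involutions-commute f g f-inv g-inv f⇒g g⇒f n with f n ≟ n | g n ≟ n
... | no f-moves | _ =
  trans (cong f (f⇒g n f-moves))
        (sym (f⇒g (f n) (λ ffn≡fn → f-moves (trans (sym ffn≡fn) (f-inv n)))))
... | yes _ | no g-moves =
  trans (g⇒f (g n) (λ ggn≡gn → g-moves (trans (sym ggn≡gn) (g-inv n))))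
        (cong g (sym (g⇒f n g-moves)))
... | yes fn≡n | yes gn≡n = trans (cong f gn≡n) (trans fn≡n (sym (trans (cong g fn≡n) gn≡n)))

transpose-commute : ∀ {a b c d} → a ≢ c → a ≢ d → b ≢ c → b ≢ d →
                    ∀ n → transpose a b (transpose c d n) ≡ transpose c d (transpose a b n)
transpose-commute {a} {b} {c} {d} a≢c a≢d b≢c b≢d =
  disjoint-involutions-commute (transpose a b) (transpose c d)
    (transpose-involutive a b) (transpose-involutive c d) ab⇒cd cd⇒ab
  where
  ab⇒cd : ∀ n → transpose a b n ≢ n → transpose c d n ≡ n
  ab⇒cd n moved with transpose-moves moved
  ... | inj₁ refl = transpose-mismatch a≢c a≢d
  ... | inj₂ refl = transpose-mismatch b≢c b≢d
  cd⇒ab : ∀ n → transpose c d n ≢ n → transpose a b n ≡ n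
  cd⇒ab n moved with transpose-moves moved
  ... | inj₁ refl = transpose-mismatch (a≢c ∘ sym) (b≢c ∘ sym)
  ... | inj₂ refl = transpose-mismatch (a≢d ∘ sym) (b≢d ∘ sym)

∘-involutive : ∀ {f g} → Involutive f → Involutive g → (∀ n → f (g n) ≡ g (f n)) → Involutive (f ∘ g)
∘-involutive {f} {g} f-inv g-inv fg≡gf n =
  trans (cong f (sym (fg≡gf (g n)))) (trans (f-inv (g (g n))) (g-inv n))

m≤n∧2≤∣m-n∣⇒2+m≤n : ∀ {m n} → m ≤ n → 2 ≤ ∣ m - n ∣ → 2 + m ≤ n
m≤n∧2≤∣m-n∣⇒2+m≤n {m} m≤n 2≤∣m-n∣ =
  subst (2 + m ≤_) (m∸n+n≡m m≤n) (+-monoˡ-≤ m (subst (2 ≤_) (m≤n⇒∣m-n∣≡n∸m m≤n) 2≤∣m-n∣))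

far-apart : ∀ m n → 2 ≤ ∣ m - n ∣ → 2 + m ≤ n ⊎ 2 + n ≤ m
far-apart m n 2≤∣m-n∣ with ≤-total m n
... | inj₁ m≤n = inj₁ (m≤n∧2≤∣m-n∣⇒2+m≤n m≤n 2≤∣m-n∣)
... | inj₂ n≤m = inj₂ (m≤n∧2≤∣m-n∣⇒2+m≤n n≤m (subst (2 ≤_) (∣-∣-comm m n) 2≤∣m-n∣))

-- Permutations of [0, N) and words in involutions

record PermutationOn (N : ℕ) (f f⁻¹ : ℕ → ℕ) : Set where
  field
    f-<      : ∀ {n} → n < N → f n < N
    f⁻¹-<    : ∀ {n} → n < N → f⁻¹ n < N
    inverseˡ : ∀ {n} → n < N → f⁻¹ (f n) ≡ n
    inverseʳ : ∀ {n} → n < N → f (f⁻¹ n) ≡ n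

  injective : ∀ {m n} → m < N → n < N → f m ≡ f n → m ≡ n
  injective m<N n<N fm≡fn = trans (sym (inverseˡ m<N)) (trans (cong f⁻¹ fm≡fn) (inverseˡ n<N))

permutationOn-id : ∀ {N} → PermutationOn N id id
permutationOn-id = record { f-< = id ; f⁻¹-< = id ; inverseˡ = λ _ → refl ; inverseʳ = λ _ → refl }

transpose-permutationOn : ∀ {N a b} → a < N → b < N → PermutationOn N (transpose a b) (transpose a b)
transpose-permutationOn a<N b<N = record
  { f-< = transpose-< a<N b<N ; f⁻¹-< = transpose-< a<N b<N
  ; inverseˡ = λ _ → transpose-involutive _ _ _ ; inverseʳ = λ _ → transpose-involutive _ _ _ }

permutationOn-sym : ∀ {N f f⁻¹} → PermutationOn N f f⁻¹ → PermutationOn N f⁻¹ f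
permutationOn-sym π = record { f-< = f⁻¹-< ; f⁻¹-< = f-< ; inverseˡ = inverseʳ ; inverseʳ = inverseˡ }
  where open PermutationOn π

permutationOn-∘ : ∀ {N f f⁻¹ g g⁻¹} → PermutationOn N f f⁻¹ → PermutationOn N g g⁻¹ →
                  PermutationOn N (f ∘ g) (g⁻¹ ∘ f⁻¹)
permutationOn-∘ {f = f} {g⁻¹ = g⁻¹} πf πg = record
  { f-<      = F.f-< ∘ G.f-<
  ; f⁻¹-<    = G.f⁻¹-< ∘ F.f⁻¹-<
  ; inverseˡ = λ n<N → trans (cong g⁻¹ (F.inverseˡ (G.f-< n<N))) (G.inverseˡ n<N)
  ; inverseʳ = λ n<N → trans (cong f (G.inverseʳ (F.f⁻¹-< n<N))) (F.inverseʳ n<N)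
  }
  where module F = PermutationOn πf; module G = PermutationOn πg

permutationOn-shrink : ∀ {N f f⁻¹} → PermutationOn (suc N) f f⁻¹ → f N ≡ N → PermutationOn N f f⁻¹
permutationOn-shrink {N} {f} {f⁻¹} π fN≡N = record
  { f-<      = λ n<N → ≤∧≢⇒< (≤-pred (f-< (lift n<N))) (f-avoids-N n<N)
  ; f⁻¹-<    = λ n<N → ≤∧≢⇒< (≤-pred (f⁻¹-< (lift n<N))) (f⁻¹-avoids-N n<N)
  ; inverseˡ = inverseˡ ∘ lift
  ; inverseʳ = inverseʳ ∘ lift
  }
  where
  open PermutationOn π
  lift : ∀ {n} → n < N → n < suc N
  lift = m<n⇒m<1+n
  f-avoids-N : ∀ {n} → n < N → f n ≢ N
  f-avoids-N n<N fn≡N = <⇒≢ n<N (injective (lift n<N) ≤-refl (trans fn≡N (sym fN≡N)))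
  f⁻¹-avoids-N : ∀ {n} → n < N → f⁻¹ n ≢ N
  f⁻¹-avoids-N {n} n<N f⁻¹n≡N = <⇒≢ n<N (trans (sym (inverseʳ (lift n<N))) (trans (cong f f⁻¹n≡N) fN≡N))

inverse-unique : ∀ {N f f⁻¹ g g⁻¹} → PermutationOn N f f⁻¹ → PermutationOn N g g⁻¹ →
                 (∀ {n} → n < N → f n ≡ g n) → ∀ {n} → n < N → f⁻¹ n ≡ g⁻¹ n
inverse-unique {f = f} {f⁻¹} {g} {g⁻¹} πf πg f≗g {n} n<N = begin
  f⁻¹ n              ≡⟨ G.inverseˡ (F.f⁻¹-< n<N) ⟨
  g⁻¹ (g (f⁻¹ n))    ≡⟨ cong g⁻¹ (f≗g (F.f⁻¹-< n<N)) ⟨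
  g⁻¹ (f (f⁻¹ n))    ≡⟨ cong g⁻¹ (F.inverseʳ n<N) ⟩
  g⁻¹ n              ∎
  where module F = PermutationOn πf; module G = PermutationOn πg

module _ {N f f⁻¹} (π : PermutationOn N f f⁻¹) where
  open PermutationOn π

  moved-to-moved : ∀ {z} → z < N → f z ≢ z → f (f z) ≢ f z
  moved-to-moved z<N fz≢z ffz≡fz = fz≢z (injective (f-< z<N) z<N ffz≡fz)

  fixes-all-but-one : ∀ {x} → (∀ {n} → n < N → n ≢ x → f n ≡ n) → ∀ {n} → n < N → f n ≡ n
  fixes-all-but-one {x} fixes {n} n<N with n ≟ x | f n ≟ n
  ... | _      | yes fn≡n = fn≡n
  ... | no n≢x | no _     = fixes n<N n≢x
  ... | yes refl | no fn≢n = ⊥-elim (moved-to-moved n<N fn≢n (fixes (f-< n<N) fn≢n))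

  moved-within : ∀ {x y} → (∀ {n} → n < N → n ≢ x → n ≢ y → f n ≡ n) →
                 ∀ {z} → z < N → f z ≢ z → f z ≡ x ⊎ f z ≡ y
  moved-within {x} {y} fixes {z} z<N fz≢z with f z ≟ x | f z ≟ y
  ... | yes fz≡x | _        = inj₁ fz≡x
  ... | no _     | yes fz≡y = inj₂ fz≡y
  ... | no fz≢x  | no fz≢y  = ⊥-elim (moved-to-moved z<N fz≢z (fixes (f-< z<N) fz≢x fz≢y))

  fixes-all-but-two : ∀ {x y} → x < N → y < N → x ≢ y → (∀ {n} → n < N → n ≢ x → n ≢ y → f n ≡ n) →
                      (∀ {n} → n < N → f n ≡ n) ⊎ (∀ {n} → n < N → f n ≡ transpose x y n)
  fixes-all-but-two {x} {y} x<N y<N x≢y fixes with f x ≟ x | f y ≟ y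
  ... | yes fx≡x | yes fy≡y = inj₁ identity
    where
    identity : ∀ {n} → n < N → f n ≡ n
    identity {n} n<N with transposeView x y n
    ... | at-a refl     = fx≡x
    ... | at-b refl     = fy≡y
    ... | other n≢x n≢y = fixes n<N n≢x n≢y
  ... | yes fx≡x | no fy≢y with moved-within fixes y<N fy≢y
  ...   | inj₁ fy≡x = ⊥-elim (x≢y (injective x<N y<N (trans fx≡x (sym fy≡x))))
  ...   | inj₂ fy≡y = ⊥-elim (fy≢y fy≡y)
  fixes-all-but-two {x} {y} x<N y<N x≢y fixes | no fx≢x | yes fy≡y with moved-within fixes x<N fx≢x
  ...   | inj₁ fx≡x = ⊥-elim (fx≢x fx≡x)
  ...   | inj₂ fx≡y = ⊥-elim (x≢y (injective x<N y<N (trans fx≡y (sym fy≡y))))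
  fixes-all-but-two {x} {y} x<N y<N x≢y fixes | no fx≢x | no fy≢y
    with moved-within fixes x<N fx≢x | moved-within fixes y<N fy≢y
  ...   | inj₁ fx≡x | _         = ⊥-elim (fx≢x fx≡x)
  ...   | _         | inj₂ fy≡y = ⊥-elim (fy≢y fy≡y)
  ...   | inj₂ fx≡y | inj₁ fy≡x = inj₂ swapped
    where
    swapped : ∀ {n} → n < N → f n ≡ transpose x y n
    swapped {n} n<N with transposeView x y n
    ... | at-a refl     = trans fx≡y (sym (transpose-matchˡ x y))
    ... | at-b refl     = trans fy≡x (sym (transpose-matchʳ x y))
    ... | other n≢x n≢y = trans (fixes n<N n≢x n≢y) (sym (transpose-mismatch n≢x n≢y))

All-reverse : ∀ {P : ℕ → Set} {xs} → All P xs → All P (reverse xs)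
All-reverse {xs = xs} = All-resp-↭ (↭-sym (↭-reverse xs))

module Words (act : ℕ → ℕ → ℕ) where

  eval : List ℕ → ℕ → ℕ
  eval []       = id
  eval (l ∷ ls) = act l ∘ eval ls

  eval-++ : ∀ xs ys n → eval (xs ++ ys) n ≡ eval xs (eval ys n)
  eval-++ []       ys n = refl
  eval-++ (x ∷ xs) ys n = cong (act x) (eval-++ xs ys n)

  eval-fixes : ∀ {n ws} → All (λ l → act l n ≡ n) ws → eval ws n ≡ n
  eval-fixes []                  = refl
  eval-fixes {n} {l ∷ _} (act-l-n≡n ∷ ps) = trans (cong (act l) (eval-fixes ps)) act-l-n≡n

  eval-< : ∀ {P : ℕ → Set} {N} → (∀ {l n} → P l → n < N → act l n < N) →
           ∀ {ws n} → All P ws → n < N → eval ws n < N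
  eval-< act-< []       n<N = n<N
  eval-< act-< (p ∷ ps) n<N = act-< p (eval-< act-< ps n<N)

  module _ (act-involutive : ∀ l → Involutive (act l)) where

    eval-reverse-inverseˡ : ∀ ws n → eval (reverse ws) (eval ws n) ≡ n
    eval-reverse-inverseˡ []       n = refl
    eval-reverse-inverseˡ (x ∷ xs) n = begin
      eval (reverse (x ∷ xs)) (act x (eval xs n))
        ≡⟨ cong (λ ws → eval ws (act x (eval xs n))) (unfold-reverse x xs) ⟩
      eval (reverse xs ++ x ∷ []) (act x (eval xs n))
        ≡⟨ eval-++ (reverse xs) (x ∷ []) (act x (eval xs n)) ⟩
      eval (reverse xs) (act x (act x (eval xs n)))
        ≡⟨ cong (eval (reverse xs)) (act-involutive x (eval xs n)) ⟩
      eval (reverse xs) (eval xs n)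
        ≡⟨ eval-reverse-inverseˡ xs n ⟩
      n ∎

    eval-reverse-inverseʳ : ∀ ws n → eval ws (eval (reverse ws) n) ≡ n
    eval-reverse-inverseʳ ws n =
      subst (λ vs → eval vs (eval (reverse ws) n) ≡ n) (reverse-involutive ws)
            (eval-reverse-inverseˡ (reverse ws) n)

    eval-permutationOn : ∀ {P : ℕ → Set} {N} → (∀ {l n} → P l → n < N → act l n < N) →
                         ∀ {ws} → All P ws → PermutationOn N (eval ws) (eval (reverse ws))
    eval-permutationOn act-< {ws} ps = record
      { f-<      = eval-< act-< ps
      ; f⁻¹-<    = eval-< act-< (All-reverse ps)
      ; inverseˡ = λ {n} _ → eval-reverse-inverseˡ ws n
      ; inverseʳ = λ {n} _ → eval-reverse-inverseʳ ws n
      }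

eval-cong : ∀ {act act′ : ℕ → ℕ → ℕ} {Q : ℕ → Set} → (∀ {l} → Q l → ∀ n → act l n ≡ act′ l n) →
            ∀ {ws} → All Q ws → ∀ n → Words.eval act ws n ≡ Words.eval act′ ws n
eval-cong act≗act′ []             n = refl
eval-cong {act} {act′} act≗act′ {l ∷ _} (ql ∷ qs) n =
  trans (cong (act l) (eval-cong act≗act′ qs n)) (act≗act′ ql _)

-- Sorting by adjacent transpositions

adjacent : ℕ → ℕ → ℕ
adjacent k = transpose k (suc k)

module Adjacent = Words adjacent

adjacent-involutive : ∀ k → Involutive (adjacent k)
adjacent-involutive k = transpose-involutive k (suc k)

adjacent-< : ∀ {k n N} → suc k < N → n < N → adjacent k n < N
adjacent-< k+1<N = transpose-< (<-trans (n<1+n _) k+1<N) k+1<N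

adjacent-fixes-below : ∀ {k n} → n < k → adjacent k n ≡ n
adjacent-fixes-below n<k = transpose-mismatch (<⇒≢ n<k) (<⇒≢ (m<n⇒m<1+n n<k))

adjacent-fixes-above : ∀ {k n} → suc k < n → adjacent k n ≡ n
adjacent-fixes-above k+1<n = transpose-mismatch (>⇒≢ (<-trans (n<1+n _) k+1<n)) (>⇒≢ k+1<n)

ascending : ℕ → ℕ → List ℕ
ascending p zero    = []
ascending p (suc d) = p ∷ ascending (suc p) d

ascending-top : ∀ p d → Adjacent.eval (ascending p d) (p + d) ≡ p
ascending-top p zero    = +-identityʳ p
ascending-top p (suc d) = begin
  adjacent p (Adjacent.eval (ascending (suc p) d) (p + suc d))
    ≡⟨ cong (adjacent p ∘ Adjacent.eval (ascending (suc p) d)) (+-suc p d) ⟩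
  adjacent p (Adjacent.eval (ascending (suc p) d) (suc p + d))
    ≡⟨ cong (adjacent p) (ascending-top (suc p) d) ⟩
  adjacent p (suc p)
    ≡⟨ transpose-matchʳ p (suc p) ⟩
  p ∎

ascending-labels : ∀ p d → All (λ k → p ≤ k × k < p + d) (ascending p d)
ascending-labels p zero    = []
ascending-labels p (suc d) =
  (≤-refl , subst (p <_) (sym (+-suc p d)) (s≤s (m≤m+n p d)))
  ∷ All.map (λ { {k} (p<k , k<) → <⇒≤ p<k , subst (k <_) (sym (+-suc p d)) k< })
            (ascending-labels (suc p) d)

PreservesUpTo : ℕ → (ℕ → ℕ) → Set
PreservesUpTo k f = ∀ {m} → m ≤ k → f m ≤ k

record AdjacentFactorisation (N : ℕ) (Allowed : ℕ → Set) (β : ℕ → ℕ) : Set where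
  field
    word      : List ℕ
    allowed   : All (λ k → Allowed k × suc k < N) word
    evaluates : ∀ {m} → m < N → Adjacent.eval word m ≡ β m

-- β = cycle ∘ β′, where the word cycle = (β n) (β n + 1) ⋯ (n - 1) sends n to β n and β′ fixes n.
module PeelTop {n β δ} (π : PermutationOn (suc n) β δ) {Allowed : ℕ → Set}
               (split : ∀ k → suc k < suc n → Allowed k ⊎ (PreservesUpTo k β × PreservesUpTo k δ)) where
  open PermutationOn π

  cycle : List ℕ
  cycle = ascending (β n) (n ∸ β n)

  β-top≤n : β n ≤ n
  β-top≤n = ≤-pred (f-< ≤-refl)

  cycle-labels : All (λ k → β n ≤ k × k < n) cycle
  cycle-labels = subst (λ m → All (λ k → β n ≤ k × k < m) cycle) (m+[n∸m]≡n β-top≤n)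
                       (ascending-labels (β n) (n ∸ β n))

  cycle-top : Adjacent.eval cycle n ≡ β n
  cycle-top = subst (λ m → Adjacent.eval cycle m ≡ β n) (m+[n∸m]≡n β-top≤n)
                    (ascending-top (β n) (n ∸ β n))

  β′ δ′ : ℕ → ℕ
  β′ = Adjacent.eval (reverse cycle) ∘ β
  δ′ = δ ∘ Adjacent.eval cycle

  cycle-permutation : PermutationOn (suc n) (Adjacent.eval cycle) (Adjacent.eval (reverse cycle))
  cycle-permutation = Adjacent.eval-permutationOn adjacent-involutive adjacent-<
                        (All.map (λ (_ , k<n) → s≤s k<n) cycle-labels)

  β′-top : β′ n ≡ n
  β′-top = trans (cong (Adjacent.eval (reverse cycle)) (sym cycle-top))
                 (Adjacent.eval-reverse-inverseˡ adjacent-involutive cycle n)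

  π′ : PermutationOn n β′ δ′
  π′ = permutationOn-shrink (permutationOn-∘ (permutationOn-sym cycle-permutation) π) β′-top

  cycle-fixes-below : ∀ {m} → m < β n → Adjacent.eval cycle m ≡ m × Adjacent.eval (reverse cycle) m ≡ m
  cycle-fixes-below m<βn =
      Adjacent.eval-fixes (fixes cycle-labels)
    , Adjacent.eval-fixes (All-reverse (fixes cycle-labels))
    where fixes = All.map (λ (βn≤k , _) → adjacent-fixes-below (<-≤-trans m<βn βn≤k))

  -- δ (β n) = n, so δ does not preserve [0, k] once β n ≤ k < n.
  preserves⇒top≤ : ∀ {k} → k < n → PreservesUpTo k δ → k < β n
  preserves⇒top≤ {k} k<n δ-preserves with β n ≤? k
  ... | no βn≰k = ≰⇒> βn≰k
  ... | yes βn≤k = ⊥-elim (<⇒≱ k<n (subst (_≤ k) (inverseˡ ≤-refl) (δ-preserves βn≤k)))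

  split′ : ∀ k → suc k < n → Allowed k ⊎ (PreservesUpTo k β′ × PreservesUpTo k δ′)
  split′ k k+1<n with split k (m<n⇒m<1+n k+1<n)
  ... | inj₁ allowed = inj₁ allowed
  ... | inj₂ (β-preserves , δ-preserves) = inj₂
    ( (λ m≤k → subst (_≤ _) (sym (proj₂ (cycle-fixes-below (≤-<-trans (β-preserves m≤k) k<βn)))) (β-preserves m≤k))
    , (λ m≤k → subst (_≤ _) (sym (cong δ (proj₁ (cycle-fixes-below (≤-<-trans m≤k k<βn))))) (δ-preserves m≤k)) )
    where k<βn = preserves⇒top≤ (<-trans (n<1+n k) k+1<n) δ-preserves

  cycle-allowed : ∀ {k} → β n ≤ k × k < n → Allowed k × suc k < suc n
  cycle-allowed {k} (βn≤k , k<n) with split k (s≤s k<n)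
  ... | inj₁ allowed = allowed , s≤s k<n
  ... | inj₂ (_ , δ-preserves) = ⊥-elim (<⇒≱ (preserves⇒top≤ k<n δ-preserves) βn≤k)

adjacent-factorisation : ∀ N (Allowed : ℕ → Set) {β δ} → PermutationOn N β δ →
  (∀ k → suc k < N → Allowed k ⊎ (PreservesUpTo k β × PreservesUpTo k δ)) →
  AdjacentFactorisation N Allowed β
adjacent-factorisation zero    Allowed π split = record { word = [] ; allowed = [] ; evaluates = λ () }
adjacent-factorisation (suc n) Allowed {β} π split = record
  { word      = cycle ++ R.word
  ; allowed   = ++⁺ (All.map cycle-allowed cycle-labels)
                    (All.map (λ (a , k+1<n) → a , m<n⇒m<1+n k+1<n) R.allowed)
  ; evaluates = evaluates
  }
  where
  open PeelTop π split
  module R = AdjacentFactorisation (adjacent-factorisation n Allowed π′ split′)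

  evaluates : ∀ {m} → m < suc n → Adjacent.eval (cycle ++ R.word) m ≡ β m
  evaluates {m} m<1+n with m<1+n⇒m<n∨m≡n m<1+n
  ... | inj₁ m<n = begin
    Adjacent.eval (cycle ++ R.word) m  ≡⟨ Adjacent.eval-++ cycle R.word m ⟩
    Adjacent.eval cycle (Adjacent.eval R.word m) ≡⟨ cong (Adjacent.eval cycle) (R.evaluates m<n) ⟩
    Adjacent.eval cycle (β′ m) ≡⟨ Adjacent.eval-reverse-inverseʳ adjacent-involutive cycle (β m) ⟩
    β m ∎
  ... | inj₂ refl = begin
    Adjacent.eval (cycle ++ R.word) n  ≡⟨ Adjacent.eval-++ cycle R.word n ⟩
    Adjacent.eval cycle (Adjacent.eval R.word n)
      ≡⟨ cong (Adjacent.eval cycle) (Adjacent.eval-fixes (All.map (adjacent-fixes-above ∘ proj₂) R.allowed)) ⟩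
    Adjacent.eval cycle n ≡⟨ cycle-top ⟩
    β n ∎

-- Permutations of Fin N as maps of ℕ

module _ {N : ℕ} where

  restrict : (f : ℕ → ℕ) → (∀ {n} → n < N → f n < N) → Fin N → Fin N
  restrict f f-< x = fromℕ< (f-< (toℕ<n x))

  toℕ-restrict : ∀ f (f-< : ∀ {n} → n < N → f n < N) x → toℕ (restrict f f-< x) ≡ f (toℕ x)
  toℕ-restrict f f-< x = toℕ-fromℕ< _

  toPermutation : ∀ {f f⁻¹} → PermutationOn N f f⁻¹ → Permutation′ N
  toPermutation {f} {f⁻¹} π = permutation (restrict f f-<) (restrict f⁻¹ f⁻¹-<)
    (λ y → toℕ-injective (trans (toℕ-restrict f f-< _)
                                (trans (cong f (toℕ-restrict f⁻¹ f⁻¹-< y)) (inverseʳ (toℕ<n y)))))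
    (λ x → toℕ-injective (trans (toℕ-restrict f⁻¹ f⁻¹-< _)
                                (trans (cong f⁻¹ (toℕ-restrict f f-< x)) (inverseˡ (toℕ<n x)))))
    where open PermutationOn π

  toℕ-toPermutation : ∀ {f f⁻¹} (π : PermutationOn N f f⁻¹) x → toℕ (toPermutation π ⟨$⟩ʳ x) ≡ f (toℕ x)
  toℕ-toPermutation π = toℕ-restrict _ (PermutationOn.f-< π)

  toℕ-toPermutation⁻¹ : ∀ {f f⁻¹} (π : PermutationOn N f f⁻¹) x →
                        toℕ (toPermutation π ⟨$⟩ˡ x) ≡ f⁻¹ (toℕ x)
  toℕ-toPermutation⁻¹ π = toℕ-restrict _ (PermutationOn.f⁻¹-< π)

  module _ {f f⁻¹ g g⁻¹} (πf : PermutationOn N f f⁻¹) (πg : PermutationOn N g g⁻¹) where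

    agree⇒toPermutation-≈ : (∀ {n} → n < N → f n ≡ g n) →
                            ∀ x → toPermutation πf ⟨$⟩ʳ x ≡ toPermutation πg ⟨$⟩ʳ x
    agree⇒toPermutation-≈ f≗g x =
      toℕ-injective (trans (toℕ-toPermutation πf x) (trans (f≗g (toℕ<n x)) (sym (toℕ-toPermutation πg x))))

    toPermutation-≈⇒agree : (∀ x → toPermutation πf ⟨$⟩ʳ x ≡ toPermutation πg ⟨$⟩ʳ x) →
                            ∀ {n} → n < N → f n ≡ g n
    toPermutation-≈⇒agree πf≈πg {n} n<N = begin
      f n                                        ≡⟨ cong f (toℕ-fromℕ< n<N) ⟨
      f (toℕ (fromℕ< n<N))                       ≡⟨ toℕ-toPermutation πf _ ⟨
      toℕ (toPermutation πf ⟨$⟩ʳ fromℕ< n<N)     ≡⟨ cong toℕ (πf≈πg _) ⟩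
      toℕ (toPermutation πg ⟨$⟩ʳ fromℕ< n<N)     ≡⟨ toℕ-toPermutation πg _ ⟩
      g (toℕ (fromℕ< n<N))                       ≡⟨ cong g (toℕ-fromℕ< n<N) ⟩
      g n                                        ∎

  extend : (Fin N → Fin N) → ℕ → ℕ
  extend g n with n <? N
  ... | yes n<N = toℕ (g (fromℕ< n<N))
  ... | no _    = n

  extend-< : ∀ g {n} (n<N : n < N) → extend g n ≡ toℕ (g (fromℕ< n<N))
  extend-< g {n} n<N with n <? N
  ... | yes _   = refl
  ... | no n≮N = contradiction n<N n≮N

  extend-toℕ : ∀ g (x : Fin N) → extend g (toℕ x) ≡ toℕ (g x)
  extend-toℕ g x = trans (extend-< g (toℕ<n x)) (cong (toℕ ∘ g) (fromℕ<-toℕ x (toℕ<n x)))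

  extend-permutationOn : (π : Permutation′ N) → PermutationOn N (extend (π ⟨$⟩ʳ_)) (extend (π ⟨$⟩ˡ_))
  extend-permutationOn π = record
    { f-<      = λ n<N → subst (_< N) (sym (extend-< _ n<N)) (toℕ<n _)
    ; f⁻¹-<    = λ n<N → subst (_< N) (sym (extend-< _ n<N)) (toℕ<n _)
    ; inverseˡ = λ n<N → round-trip (π ⟨$⟩ʳ_) (π ⟨$⟩ˡ_) (Perm.inverseˡ π) n<N
    ; inverseʳ = λ n<N → round-trip (π ⟨$⟩ˡ_) (π ⟨$⟩ʳ_) (Perm.inverseʳ π) n<N
    }
    where
    round-trip : ∀ g h → (∀ {x} → h (g x) ≡ x) → ∀ {n} → n < N → extend h (extend g n) ≡ n
    round-trip g h h∘g≡id {n} n<N = begin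
      extend h (extend g n)                ≡⟨ cong (extend h) (extend-< g n<N) ⟩
      extend h (toℕ (g (fromℕ< n<N)))      ≡⟨ extend-toℕ h (g (fromℕ< n<N)) ⟩
      toℕ (h (g (fromℕ< n<N)))             ≡⟨ cong toℕ h∘g≡id ⟩
      toℕ (fromℕ< n<N)                     ≡⟨ toℕ-fromℕ< n<N ⟩
      n                                    ∎

-- Edge-labelled graphs

module _ {Ω : Set} (_≟ᵥ_ : DecidableEquality Ω) where

  ρ-unique : ∀ E l x y →
    (∀ {c d} → (l , c , d) ∈ E → (x ≡ c → d ≡ y) × (x ≡ d → c ≡ y)) →
    ((∀ {c d} → (l , c , d) ∈ E → x ≢ c × x ≢ d) → x ≡ y) →
    Graph.ρ _≟ᵥ_ E l x ≡ y
  ρ-unique []                  l x y at-edge off-edges = off-edges (λ ())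
  ρ-unique ((l′ , a , b) ∷ es) l x y at-edge off-edges with l ≟ l′
  ... | no l≢l′ = ρ-unique es l x y (at-edge ∘ there)
                    (λ off-es → off-edges λ { (here refl) → ⊥-elim (l≢l′ refl) ; (there c,d∈es) → off-es c,d∈es })
  ... | yes refl with x ≟ᵥ a
  ...   | yes x≡a = proj₁ (at-edge (here refl)) x≡a
  ...   | no x≢a with x ≟ᵥ b
  ...     | yes x≡b = proj₂ (at-edge (here refl)) x≡b
  ...     | no x≢b  = ρ-unique es l x y (at-edge ∘ there)
                        (λ off-es → off-edges λ { (here refl) → x≢a , x≢b ; (there c,d∈es) → off-es c,d∈es })

∈-pathEdges⁻ : ∀ n {l a b} → (l , a , b) ∈ pathEdges n → toℕ a ≡ l × toℕ b ≡ suc l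
∈-pathEdges⁻ (suc (suc n)) (here refl) = refl , refl
∈-pathEdges⁻ (suc (suc n)) (there e∈) with ∈-map⁻ _ e∈
... | _ , e′∈ , refl with ∈-pathEdges⁻ (suc n) e′∈
...   | a≡l , b≡1+l = cong suc a≡l , cong suc b≡1+l

∈-pathEdges⁺ : ∀ n l → suc l < n →
               Σ[ a ∈ Fin n ] Σ[ b ∈ Fin n ] (l , a , b) ∈ pathEdges n × toℕ a ≡ l × toℕ b ≡ suc l
∈-pathEdges⁺ (suc zero)    _       (s≤s ())
∈-pathEdges⁺ (suc (suc n)) zero    _ = Fin.zero , Fin.suc Fin.zero , here refl , refl , refl
∈-pathEdges⁺ (suc (suc n)) (suc l) (s≤s l+1<n) with ∈-pathEdges⁺ (suc n) l l+1<n
... | a , b , e∈ , a≡l , b≡1+l = Fin.suc a , Fin.suc b , there (∈-map⁺ _ e∈) , cong suc a≡l , cong suc b≡1+l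

two-cycles : ∀ {A : Set} (s : A → A) {a b c d} → s a ≡ b × s b ≡ a → s c ≡ d × s d ≡ c →
             a ≡ c ⊎ a ≡ d ⊎ b ≡ c ⊎ b ≡ d → (a ≡ c × b ≡ d) ⊎ (a ≡ d × b ≡ c)
two-cycles s (sa≡b , sb≡a) (sc≡d , sd≡c) (inj₁ refl)               = inj₁ (refl , trans (sym sa≡b) sc≡d)
two-cycles s (sa≡b , sb≡a) (sc≡d , sd≡c) (inj₂ (inj₁ refl))        = inj₂ (refl , trans (sym sa≡b) sd≡c)
two-cycles s (sa≡b , sb≡a) (sc≡d , sd≡c) (inj₂ (inj₂ (inj₁ refl))) = inj₂ (trans (sym sb≡a) sc≡d , refl)
two-cycles s (sa≡b , sb≡a) (sc≡d , sd≡c) (inj₂ (inj₂ (inj₂ refl))) = inj₁ (trans (sym sb≡a) sd≡c , refl)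


-- On A (vertex j ↦ j - 1) ρ_l acts as actA l, on B (w_j ↦ j - 1) as actB l. The extra edge
-- {r + 1, r + 2} has label r - 2 = 1 + q and joins 3 + q and 4 + q; B has no edge of label 2 + q.
module Action (q : ℕ) where

  ≢-shift : ∀ i j {i≢j : False (i ≟ j)} → i + q ≢ j + q
  ≢-shift i j {i≢j} = toWitnessFalse i≢j ∘ +-cancelʳ-≡ q i j

  <-shift : ∀ i j {i<j : True (i <? j)} → i + q < j + q
  <-shift i j {i<j} = +-monoˡ-< q (toWitness i<j)

  t₁₂ t₃₄ : ℕ → ℕ
  t₁₂ = transpose (1 + q) (2 + q)
  t₃₄ = transpose (3 + q) (4 + q)

  opaque
    actA : ℕ → ℕ → ℕ
    actA l with l ≟ 1 + q
    ... | yes _ = t₁₂ ∘ t₃₄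
    ... | no _  = adjacent l

    actA-1+q : ∀ n → actA (1 + q) n ≡ t₁₂ (t₃₄ n)
    actA-1+q n with 1 + q ≟ 1 + q
    ... | yes _   = refl
    ... | no 1+q≢ = ⊥-elim (1+q≢ refl)

    actA-≢1+q : ∀ {l} → l ≢ 1 + q → ∀ n → actA l n ≡ adjacent l n
    actA-≢1+q {l} l≢1+q n with l ≟ 1 + q
    ... | yes l≡1+q = ⊥-elim (l≢1+q l≡1+q)
    ... | no _      = refl

    actB : ℕ → ℕ → ℕ
    actB l with l ≟ 2 + q
    ... | yes _ = id
    ... | no _  = adjacent l

    actB-2+q : ∀ n → actB (2 + q) n ≡ n
    actB-2+q n with 2 + q ≟ 2 + q
    ... | yes _   = refl
    ... | no 2+q≢ = ⊥-elim (2+q≢ refl)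

    actB-≢2+q : ∀ {l} → l ≢ 2 + q → ∀ n → actB l n ≡ adjacent l n
    actB-≢2+q {l} l≢2+q n with l ≟ 2 + q
    ... | yes l≡2+q = ⊥-elim (l≢2+q l≡2+q)
    ... | no _      = refl

  t₁₂-t₃₄-commute : ∀ n → t₁₂ (t₃₄ n) ≡ t₃₄ (t₁₂ n)
  t₁₂-t₃₄-commute = transpose-commute (≢-shift 1 3) (≢-shift 1 4) (≢-shift 2 3) (≢-shift 2 4)

  actA-involutive : ∀ l → Involutive (actA l)
  actA-involutive l n with l ≟ 1 + q
  ... | no l≢1+q = trans (actA-≢1+q l≢1+q _) (trans (cong (adjacent l) (actA-≢1+q l≢1+q n)) (adjacent-involutive l n))
  ... | yes refl = begin
    actA (1 + q) (actA (1 + q) n) ≡⟨ actA-1+q _ ⟩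
    t₁₂ (t₃₄ (actA (1 + q) n))    ≡⟨ cong (t₁₂ ∘ t₃₄) (actA-1+q n) ⟩
    t₁₂ (t₃₄ (t₁₂ (t₃₄ n)))       ≡⟨ cong t₁₂ (sym (t₁₂-t₃₄-commute (t₃₄ n))) ⟩
    t₁₂ (t₁₂ (t₃₄ (t₃₄ n)))       ≡⟨ transpose-involutive (1 + q) (2 + q) _ ⟩
    t₃₄ (t₃₄ n)                   ≡⟨ transpose-involutive (3 + q) (4 + q) n ⟩
    n                             ∎

  actB-involutive : ∀ l → Involutive (actB l)
  actB-involutive l n with l ≟ 2 + q
  ... | yes refl = trans (actB-2+q _) (actB-2+q n)
  ... | no l≢2+q = trans (actB-≢2+q l≢2+q _) (trans (cong (adjacent l) (actB-≢2+q l≢2+q n)) (adjacent-involutive l n))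

  actA-< : ∀ {l n} → l ≤ 2 + q → n < 5 + q → actA l n < 5 + q
  actA-< {l} {n} l≤2+q n<5+q with l ≟ 1 + q
  ... | yes refl = subst (_< 5 + q) (sym (actA-1+q n))
                     (transpose-< (<-shift 1 5) (<-shift 2 5) (transpose-< (<-shift 3 5) (<-shift 4 5) n<5+q))
  ... | no l≢1+q = subst (_< 5 + q) (sym (actA-≢1+q l≢1+q n)) (adjacent-< (s≤s (s≤s (≤-trans l≤2+q (n≤1+n _)))) n<5+q)

  actB-< : ∀ {l n} → l ≤ 2 + q → n < 3 + q → actB l n < 3 + q
  actB-< {l} {n} l≤2+q n<3+q with l ≟ 2 + q
  ... | yes refl = subst (_< 3 + q) (sym (actB-2+q n)) n<3+q
  ... | no l≢2+q = subst (_< 3 + q) (sym (actB-≢2+q l≢2+q n)) (adjacent-< (s≤s (≤∧≢⇒< l≤2+q l≢2+q)) n<3+q)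

  actA-fixes-below : ∀ {l n} → n < l → actA l n ≡ n
  actA-fixes-below {l} {n} n<l with l ≟ 1 + q
  ... | no l≢1+q = trans (actA-≢1+q l≢1+q n) (adjacent-fixes-below n<l)
  ... | yes refl = trans (actA-1+q n)
                         (trans (cong t₁₂ (transpose-mismatch (below 2) (below 3)))
                                (transpose-mismatch (<⇒≢ n<l) (below 1)))
    where below : ∀ i → n ≢ suc i + q
          below i = <⇒≢ (<-≤-trans n<l (s≤s (m≤n+m q i)))

  actB-fixes-below : ∀ {l n} → n < l → actB l n ≡ n
  actB-fixes-below {l} {n} n<l with l ≟ 2 + q
  ... | yes refl = actB-2+q n
  ... | no l≢2+q = trans (actB-≢2+q l≢2+q n) (adjacent-fixes-below n<l)

  actA-fixes-above : ∀ {l n} → l ≢ 1 + q → suc l < n → actA l n ≡ n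
  actA-fixes-above l≢1+q l+1<n = trans (actA-≢1+q l≢1+q _) (adjacent-fixes-above l+1<n)

  actB-fixes-above : ∀ {l n} → suc l < n → actB l n ≡ n
  actB-fixes-above {l} {n} l+1<n with l ≟ 2 + q
  ... | yes refl = actB-2+q n
  ... | no l≢2+q = trans (actB-≢2+q l≢2+q n) (adjacent-fixes-above l+1<n)

  actA-adjacent : ∀ {l n} → l ≤ 1 + q → n ≤ 2 + q → actA l n ≡ adjacent l n
  actA-adjacent {l} {n} l≤1+q n≤2+q with l ≟ 1 + q
  ... | no l≢1+q = actA-≢1+q l≢1+q n
  ... | yes refl =
    trans (actA-1+q n) (cong t₁₂ (transpose-mismatch (<⇒≢ (s≤s n≤2+q)) (<⇒≢ (m<n⇒m<1+n (s≤s n≤2+q)))))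

  actB-adjacent : ∀ {l} → l ≤ 1 + q → ∀ n → actB l n ≡ adjacent l n
  actB-adjacent l≤1+q = actB-≢2+q (<⇒≢ (s≤s l≤1+q))

  actA-moves : ∀ {l n} → actA l n ≢ n → (n ≡ l ⊎ n ≡ suc l) ⊎ (l ≡ 1 + q × (n ≡ 3 + q ⊎ n ≡ 4 + q))
  actA-moves {l} {n} moved with l ≟ 1 + q
  ... | no l≢1+q = inj₁ (transpose-moves (moved ∘ trans (actA-≢1+q l≢1+q n)))
  ... | yes refl with transposeView (3 + q) (4 + q) n
  ...   | at-a n≡3+q = inj₂ (refl , inj₁ n≡3+q)
  ...   | at-b n≡4+q = inj₂ (refl , inj₂ n≡4+q)
  ...   | other n≢3+q n≢4+q =
          inj₁ (transpose-moves λ t₁₂n≡n →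
                  moved (trans (actA-1+q n) (trans (cong t₁₂ (transpose-mismatch n≢3+q n≢4+q)) t₁₂n≡n)))

  actB-moves : ∀ {l n} → actB l n ≢ n → l ≢ 2 + q × (n ≡ l ⊎ n ≡ suc l)
  actB-moves {l} {n} moved with l ≟ 2 + q
  ... | yes refl = ⊥-elim (moved (actB-2+q n))
  ... | no l≢2+q = l≢2+q , transpose-moves (moved ∘ trans (actB-≢2+q l≢2+q n))

  actA-at-l : ∀ l → actA l l ≡ suc l
  actA-at-l l with l ≟ 1 + q
  ... | no l≢1+q = trans (actA-≢1+q l≢1+q l) (transpose-matchˡ l (suc l))
  ... | yes refl = trans (actA-adjacent ≤-refl (n≤1+n _)) (transpose-matchˡ l (suc l))

  actA-at-suc-l : ∀ l → actA l (suc l) ≡ l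
  actA-at-suc-l l with l ≟ 1 + q
  ... | no l≢1+q = trans (actA-≢1+q l≢1+q (suc l)) (transpose-matchʳ l (suc l))
  ... | yes refl = trans (actA-adjacent ≤-refl ≤-refl) (transpose-matchʳ l (suc l))

  actA-1+q-at-3+q : actA (1 + q) (3 + q) ≡ 4 + q
  actA-1+q-at-3+q = trans (actA-1+q (3 + q))
    (trans (cong t₁₂ (transpose-matchˡ (3 + q) (4 + q))) (transpose-mismatch (≢-shift 4 1) (≢-shift 4 2)))

  actA-1+q-at-4+q : actA (1 + q) (4 + q) ≡ 3 + q
  actA-1+q-at-4+q = trans (actA-1+q (4 + q))
    (trans (cong t₁₂ (transpose-matchʳ (3 + q) (4 + q))) (transpose-mismatch (≢-shift 3 1) (≢-shift 3 2)))

  actA-2+q-at-1+q : actA (2 + q) (1 + q) ≡ 1 + q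
  actA-2+q-at-1+q = actA-fixes-below ≤-refl

  actA-2+q-at-4+q : actA (2 + q) (4 + q) ≡ 4 + q
  actA-2+q-at-4+q = actA-fixes-above (≢-shift 2 1) ≤-refl

  actB-at-l : ∀ {l} → l ≤ 1 + q → actB l l ≡ suc l
  actB-at-l l≤1+q = trans (actB-adjacent l≤1+q _) (transpose-matchˡ _ _)

  actB-at-suc-l : ∀ {l} → l ≤ 1 + q → actB l (suc l) ≡ l
  actB-at-suc-l l≤1+q = trans (actB-adjacent l≤1+q _) (transpose-matchʳ _ _)

  actA-commute : ∀ {i j} → 2 + i ≤ j → j ≤ 2 + q → ∀ n → actA i (actA j n) ≡ actA j (actA i n)
  actA-commute {i} {j} i+2≤j j≤2+q =
    disjoint-involutions-commute (actA i) (actA j) (actA-involutive i) (actA-involutive j) i⇒j j⇒i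
    where
    i≢1+q : i ≢ 1 + q
    i≢1+q refl = 1+n≰n (≤-trans i+2≤j j≤2+q)
    i⇒j : ∀ n → actA i n ≢ n → actA j n ≡ n
    i⇒j n moved with actA-moves moved
    ... | inj₁ (inj₁ refl) = actA-fixes-below (≤-trans (n≤1+n _) i+2≤j)
    ... | inj₁ (inj₂ refl) = actA-fixes-below i+2≤j
    ... | inj₂ (i≡1+q , _) = ⊥-elim (i≢1+q i≡1+q)
    j⇒i : ∀ n → actA j n ≢ n → actA i n ≡ n
    j⇒i n moved with actA-moves moved
    ... | inj₁ (inj₁ refl)        = actA-fixes-above i≢1+q i+2≤j
    ... | inj₁ (inj₂ refl)        = actA-fixes-above i≢1+q (m≤n⇒m≤1+n i+2≤j)
    ... | inj₂ (refl , inj₁ refl) = actA-fixes-above i≢1+q (≤-trans i+2≤j (m≤n+m _ 2))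
    ... | inj₂ (refl , inj₂ refl) = actA-fixes-above i≢1+q (≤-trans i+2≤j (m≤n+m _ 3))

  actB-commute : ∀ {i j} → 2 + i ≤ j → ∀ n → actB i (actB j n) ≡ actB j (actB i n)
  actB-commute {i} {j} i+2≤j =
    disjoint-involutions-commute (actB i) (actB j) (actB-involutive i) (actB-involutive j) i⇒j j⇒i
    where
    i⇒j : ∀ n → actB i n ≢ n → actB j n ≡ n
    i⇒j n moved with actB-moves moved
    ... | _ , inj₁ refl = actB-fixes-below (≤-trans (n≤1+n _) i+2≤j)
    ... | _ , inj₂ refl = actB-fixes-below i+2≤j
    j⇒i : ∀ n → actB j n ≢ n → actB i n ≡ n
    j⇒i n moved with actB-moves moved
    ... | _ , inj₁ refl = actB-fixes-above i+2≤j
    ... | _ , inj₂ refl = actB-fixes-above (m≤n⇒m≤1+n i+2≤j)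

  module A = Words actA
  module B = Words actB

  infix 4 _≈ᴬ_ _≈ᴮ_
  _≈ᴬ_ _≈ᴮ_ : (ℕ → ℕ) → (ℕ → ℕ) → Set
  f ≈ᴬ g = ∀ {n} → n < 5 + q → f n ≡ g n
  f ≈ᴮ g = ∀ {n} → n < 3 + q → f n ≡ g n

module Parabolics (q : ℕ) where
  open Action q

  -- Indexed by (α (1 + q), α (4 + q), β (1 + q)): the dihedral group ⟨ρ_{q+1}, ρ_{q+2}⟩ acts on the
  -- square with diagonals {q+1, q+4} and {q+2, q+3}, and on B it records whether the diagonals are swapped.
  data SquareImage : ℕ → ℕ → ℕ → Set where
    to₁ : SquareImage (1 + q) (4 + q) (1 + q)
    to₄ : SquareImage (4 + q) (1 + q) (1 + q)
    to₂ : SquareImage (2 + q) (3 + q) (2 + q)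
    to₃ : SquareImage (3 + q) (2 + q) (2 + q)

  square-resp : ∀ {a b c a′ b′ c′} → a ≡ a′ → b ≡ b′ → c ≡ c′ →
                SquareImage a b c → SquareImage a′ b′ c′
  square-resp refl refl refl s = s

  square-bound : ∀ {a b c} → SquareImage a b c → 1 + q ≤ a × 1 + q ≤ b × 1 + q ≤ c
  square-bound to₁ = ≤-refl , m≤n+m _ 3 , ≤-refl
  square-bound to₄ = m≤n+m _ 3 , ≤-refl , ≤-refl
  square-bound to₂ = n≤1+n _ , m≤n+m _ 2 , n≤1+n _
  square-bound to₃ = m≤n+m _ 2 , n≤1+n _ , n≤1+n _

  square-step-1+q : ∀ {a b c} → SquareImage a b c → SquareImage (actA (1 + q) a) (actA (1 + q) b) (actB (1 + q) c)
  square-step-1+q to₁ rewrite actA-at-l (1 + q)     | actA-1+q-at-4+q | actB-at-l ≤-refl     = to₂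
  square-step-1+q to₄ rewrite actA-at-l (1 + q)     | actA-1+q-at-4+q | actB-at-l ≤-refl     = to₃
  square-step-1+q to₂ rewrite actA-at-suc-l (1 + q) | actA-1+q-at-3+q | actB-at-suc-l ≤-refl = to₁
  square-step-1+q to₃ rewrite actA-at-suc-l (1 + q) | actA-1+q-at-3+q | actB-at-suc-l ≤-refl = to₄

  square-step-2+q : ∀ {a b c} → SquareImage a b c → SquareImage (actA (2 + q) a) (actA (2 + q) b) (actB (2 + q) c)
  square-step-2+q to₁ rewrite actA-2+q-at-1+q | actA-2+q-at-4+q | actB-2+q (1 + q) = to₁
  square-step-2+q to₄ rewrite actA-2+q-at-1+q | actA-2+q-at-4+q | actB-2+q (1 + q) = to₄
  square-step-2+q to₂ rewrite actA-at-l (2 + q) | actA-at-suc-l (2 + q) | actB-2+q (2 + q) = to₃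
  square-step-2+q to₃ rewrite actA-at-l (2 + q) | actA-at-suc-l (2 + q) | actB-2+q (2 + q) = to₂

  square-step : ∀ {j a b c} → j ≤ 2 + q → j ≢ q → SquareImage a b c →
                SquareImage (actA j a) (actA j b) (actB j c)
  square-step {j} j≤2+q j≢q s with <-cmp j q
  ... | tri≈ _ j≡q _ = ⊥-elim (j≢q j≡q)
  ... | tri< j<q _ _ =
    square-resp (sym (fixA a-bound)) (sym (fixA b-bound)) (sym (actB-fixes-above (≤-trans (s≤s j<q) c-bound))) s
    where
    a-bound = proj₁ (square-bound s); b-bound = proj₁ (proj₂ (square-bound s)); c-bound = proj₂ (proj₂ (square-bound s))
    fixA : ∀ {x} → 1 + q ≤ x → actA j x ≡ x
    fixA 1+q≤x = actA-fixes-above (<⇒≢ (m<n⇒m<1+n j<q)) (≤-trans (s≤s j<q) 1+q≤x)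
  ... | tri> _ _ q<j with m≤n⇒m<n∨m≡n j≤2+q
  ...   | inj₂ refl = square-step-2+q s
  ...   | inj₁ j<2+q with ≤-antisym (≤-pred j<2+q) q<j
  ...     | refl = square-step-1+q s

  square-fixing-B : ∀ {a b} → SquareImage a b (1 + q) → (a ≡ 1 + q × b ≡ 4 + q) ⊎ (a ≡ 4 + q × b ≡ 1 + q)
  square-fixing-B to₁ = inj₁ (refl , refl)
  square-fixing-B to₄ = inj₂ (refl , refl)

  AgreeUpTo : ℕ → (ℕ → ℕ) → (ℕ → ℕ) → Set
  AgreeUpTo k α β = ∀ {m} → m ≤ k → α m ≤ k × β m ≡ α m

  -- Parabolic k α β characterises the elements of ⟨ρ_j : j ≢ k⟩, acting as α on A and as β on B.
  record Parabolic (k : ℕ) (α β : ℕ → ℕ) : Set where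
    field
      lower  : AgreeUpTo k α β
      square : k ≡ q → SquareImage (α (1 + q)) (α (4 + q)) (β (1 + q))
      top    : k ≡ 1 + q → α (4 + q) ≡ 4 + q

    preserves-β : PreservesUpTo k β
    preserves-β m≤k = subst (_≤ k) (sym (proj₂ (lower m≤k))) (proj₁ (lower m≤k))

  parabolic-step : ∀ {k j α β} → k ≤ 2 + q → j ≤ 2 + q → j ≢ k → Parabolic k α β →
                   Parabolic k (actA j ∘ α) (actB j ∘ β)
  parabolic-step {k} {j} {α} {β} k≤2+q j≤2+q j≢k p = record
    { lower  = lower′
    ; square = λ { refl → square-step j≤2+q j≢k (square refl) }
    ; top    = λ { refl → trans (cong (actA j) (top refl)) (actA-fixes-above j≢k (s≤s (s≤s j≤2+q))) }
    }
    where
    open Parabolic p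
    lower′ : AgreeUpTo k (actA j ∘ α) (actB j ∘ β)
    lower′ {m} m≤k with lower m≤k | <-cmp j k
    ... | _ | tri≈ _ j≡k _ = ⊥-elim (j≢k j≡k)
    ... | αm≤k , βm≡αm | tri< j<k _ _ =
        subst (_≤ k) (sym αj) (≤-pred (adjacent-< (s≤s j<k) (s≤s αm≤k)))
      , trans (cong (actB j) βm≡αm) (trans (actB-adjacent j≤1+q (α m)) (sym αj))
      where
      j≤1+q = ≤-pred (<-≤-trans j<k k≤2+q)
      αj : actA j (α m) ≡ adjacent j (α m)
      αj = actA-adjacent j≤1+q (≤-trans αm≤k k≤2+q)
    ... | αm≤k , βm≡αm | tri> _ _ k<j =
        subst (_≤ k) (sym αj) αm≤k
      , trans (cong (actB j) βm≡αm) (trans (actB-fixes-below (≤-<-trans αm≤k k<j)) (sym αj))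
      where
      αj : actA j (α m) ≡ α m
      αj = actA-fixes-below (≤-<-trans αm≤k k<j)

  parabolic-id : ∀ k → Parabolic k id id
  parabolic-id k = record { lower = λ m≤k → m≤k , refl ; square = λ _ → to₁ ; top = λ _ → refl }

  parabolic-eval : ∀ {k α β} → k ≤ 2 + q → ∀ {ws} → All (λ j → j ≤ 2 + q × j ≢ k) ws →
                   Parabolic k α β → Parabolic k (A.eval ws ∘ α) (B.eval ws ∘ β)
  parabolic-eval k≤2+q []                   p = p
  parabolic-eval k≤2+q ((j≤2+q , j≢k) ∷ js) p = parabolic-step k≤2+q j≤2+q j≢k (parabolic-eval k≤2+q js p)

  parabolic-resp : ∀ {k α β α′ β′} → k ≤ 2 + q →
                   α ≈ᴬ α′ → β ≈ᴮ β′ → Parabolic k α β → Parabolic k α′ β′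
  parabolic-resp {k} k≤2+q α≗α′ β≗β′ p = record
    { lower  = λ m≤k → subst (_≤ k) (α≗α′ (<A m≤k)) (proj₁ (lower m≤k))
                      , trans (sym (β≗β′ (<B m≤k))) (trans (proj₂ (lower m≤k)) (α≗α′ (<A m≤k)))
    ; square = square-resp (α≗α′ (<-shift 1 5)) (α≗α′ (<-shift 4 5)) (β≗β′ (<-shift 1 3)) ∘ square
    ; top    = λ k≡1+q → trans (sym (α≗α′ (<-shift 4 5))) (top k≡1+q)
    }
    where
    open Parabolic p
    <B : ∀ {m} → m ≤ k → m < 3 + q
    <B m≤k = s≤s (≤-trans m≤k k≤2+q)
    <A : ∀ {m} → m ≤ k → m < 5 + q
    <A m≤k = <-≤-trans (<B m≤k) (m≤n+m _ 2)

module PureWords (q : ℕ) where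
  open Action q

  record ActsAs (ws : List ℕ) (f g : ℕ → ℕ) : Set where
    constructor actsAs
    field
      onA : ∀ n → A.eval ws n ≡ f n
      onB : ∀ n → B.eval ws n ≡ g n

  PureTransposition : List ℕ → ℕ → ℕ → Set
  PureTransposition ws x y = ActsAs ws (transpose x y) id

  actsAs-generator : ∀ j → ActsAs (j ∷ []) (actA j) (actB j)
  actsAs-generator j = actsAs (λ _ → refl) (λ _ → refl)

  actsAs-++ : ∀ {U W f g f′ g′} → ActsAs U f g → ActsAs W f′ g′ → ActsAs (U ++ W) (f ∘ f′) (g ∘ g′)
  actsAs-++ {U} {W} {f} {g} (actsAs onA onB) (actsAs onA′ onB′) = actsAs
    (λ n → trans (A.eval-++ U W n) (trans (cong (A.eval U) (onA′ n)) (onA _)))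
    (λ n → trans (B.eval-++ U W n) (trans (cong (B.eval U) (onB′ n)) (onB _)))

  actsAs-resp : ∀ {U f g f′ g′} → (∀ n → f n ≡ f′ n) → (∀ n → g n ≡ g′ n) →
                ActsAs U f g → ActsAs U f′ g′
  actsAs-resp f≗f′ g≗g′ (actsAs onA onB) = actsAs (λ n → trans (onA n) (f≗f′ n)) (λ n → trans (onB n) (g≗g′ n))

  actsAs-conjugate : ∀ {U W f g f′ g′} → ActsAs U f g → ActsAs W f′ g′ →
                     ActsAs (U ++ W ++ U) (f ∘ f′ ∘ f) (g ∘ g′ ∘ g)
  actsAs-conjugate u w = actsAs-++ u (actsAs-++ w u)

  conjugate : ∀ {U W f g x y} → ActsAs U f g → Involutive f → Involutive g →
              PureTransposition W x y → PureTransposition (U ++ W ++ U) (f x) (f y)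
  conjugate {f = f} {x = x} {y} u f-inv g-inv w =
    actsAs-resp (transpose-conjugate f f-inv x y) g-inv (actsAs-conjugate u w)

  conjugate-by-generator : ∀ j {W x y} → PureTransposition W x y →
                           PureTransposition (j ∷ W ++ j ∷ []) (actA j x) (actA j y)
  conjugate-by-generator j = conjugate (actsAs-generator j) (actA-involutive j) (actB-involutive j)

  conjugate-by-transposition : ∀ {U W a b x y} → PureTransposition U a b → PureTransposition W x y →
                               PureTransposition (U ++ W ++ U) (transpose a b x) (transpose a b y)
  conjugate-by-transposition {a = a} {b} u = conjugate u (transpose-involutive a b) (λ _ → refl)

  pure-sym : ∀ {W x y} → PureTransposition W x y → PureTransposition W y x
  pure-sym {x = x} {y} = actsAs-resp (transpose-sym x y) (λ _ → refl)

  pure-resp : ∀ {W x y x′ y′} → x ≡ x′ → y ≡ y′ → PureTransposition W x y → PureTransposition W x′ y′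
  pure-resp refl refl w = w

  LabelsFrom : ℕ → List ℕ → Set
  LabelsFrom lo = All (λ j → lo ≤ j × j ≤ 2 + q)

  w₂₃ : List ℕ
  w₂₃ = 2 + q ∷ []

  w₂₃-pure : PureTransposition w₂₃ (2 + q) (3 + q)
  w₂₃-pure = actsAs (actA-≢1+q (≢-shift 2 1)) actB-2+q

  label₀ : q ≤ q × q ≤ 2 + q
  label₀ = ≤-refl , m≤n+m q 2

  label₁ : q ≤ 1 + q × 1 + q ≤ 2 + q
  label₁ = n≤1+n q , n≤1+n _

  label₂ : q ≤ 2 + q × 2 + q ≤ 2 + q
  label₂ = m≤n+m q 2 , ≤-refl

  w₂₃-labels : LabelsFrom q w₂₃
  w₂₃-labels = label₂ ∷ []

  w₁₄ : List ℕ
  w₁₄ = 1 + q ∷ w₂₃ ++ 1 + q ∷ []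

  w₁₄-labels : LabelsFrom q w₁₄
  w₁₄-labels = label₁ ∷ label₂ ∷ label₁ ∷ []

  w₁₄-pure : PureTransposition w₁₄ (1 + q) (4 + q)
  w₁₄-pure = pure-resp (actA-at-suc-l (1 + q)) actA-1+q-at-3+q (conjugate-by-generator (1 + q) w₂₃-pure)

  -- Unlike a conjugate of ρ_{q+2}, (ρ_{q+1} ρ_q)³ avoids the label q + 2.
  w₃₄ : List ℕ
  w₃₄ = 1 + q ∷ q ∷ 1 + q ∷ q ∷ 1 + q ∷ q ∷ []

  w₃₄-labels : LabelsFrom q w₃₄
  w₃₄-labels = label₁ ∷ label₀ ∷ label₁ ∷ label₀ ∷ label₁ ∷ label₀ ∷ []

  w₃₄-pure : PureTransposition w₃₄ (3 + q) (4 + q)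
  w₃₄-pure = actsAs-resp (λ n → transpose-involutive q (2 + q) (t₃₄ n)) (transpose-involutive q (2 + q))
                         (actsAs-++ {U = 1 + q ∷ q ∷ 1 + q ∷ []} aba bab)
    where
    t₀₁ t₀₂ : ℕ → ℕ
    t₀₁ = adjacent q
    t₀₂ = transpose q (2 + q)

    generator-q : ActsAs (q ∷ []) t₀₁ t₀₁
    generator-q = actsAs (actA-≢1+q (≢-shift 0 1)) (actB-adjacent (n≤1+n q))

    aba : ActsAs (1 + q ∷ q ∷ 1 + q ∷ []) t₀₂ t₀₂
    aba = actsAs-resp
      (λ n → trans (transpose-conjugate (actA (1 + q)) (actA-involutive (1 + q)) q (1 + q) n)
                   (cong₂ (λ a b → transpose a b n) (actA-fixes-below ≤-refl) (actA-at-l (1 + q))))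
      (λ n → trans (transpose-conjugate (actB (1 + q)) (actB-involutive (1 + q)) q (1 + q) n)
                   (cong₂ (λ a b → transpose a b n) (actB-fixes-below ≤-refl) (actB-at-l ≤-refl)))
      (actsAs-conjugate (actsAs-generator (1 + q)) generator-q)

    t₀₁t₁₂t₀₁ : ∀ n → t₀₁ (t₁₂ (t₀₁ n)) ≡ t₀₂ n
    t₀₁t₁₂t₀₁ n = trans (transpose-conjugate t₀₁ (adjacent-involutive q) (1 + q) (2 + q) n)
                        (cong₂ (λ a b → transpose a b n) (transpose-matchʳ q (1 + q)) (adjacent-fixes-above ≤-refl))

    t₀₁t₃₄t₀₁ : ∀ n → t₀₁ (t₃₄ (t₀₁ n)) ≡ t₃₄ n
    t₀₁t₃₄t₀₁ n = trans (transpose-conjugate t₀₁ (adjacent-involutive q) (3 + q) (4 + q) n)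
                        (cong₂ (λ a b → transpose a b n) (adjacent-fixes-above (<-shift 1 3))
                                                         (adjacent-fixes-above (<-shift 1 4)))

    bab : ActsAs (q ∷ 1 + q ∷ q ∷ []) (t₀₂ ∘ t₃₄) t₀₂
    bab = actsAs-resp
      (λ n → begin
        t₀₁ (actA (1 + q) (t₀₁ n))          ≡⟨ cong t₀₁ (actA-1+q (t₀₁ n)) ⟩
        t₀₁ (t₁₂ (t₃₄ (t₀₁ n)))             ≡⟨ cong (t₀₁ ∘ t₁₂) (adjacent-involutive q (t₃₄ (t₀₁ n))) ⟨
        t₀₁ (t₁₂ (t₀₁ (t₀₁ (t₃₄ (t₀₁ n))))) ≡⟨ t₀₁t₁₂t₀₁ (t₀₁ (t₃₄ (t₀₁ n))) ⟩
        t₀₂ (t₀₁ (t₃₄ (t₀₁ n)))             ≡⟨ cong t₀₂ (t₀₁t₃₄t₀₁ n) ⟩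
        t₀₂ (t₃₄ n)                         ∎)
      (λ n → trans (cong t₀₁ (actB-adjacent ≤-refl (t₀₁ n))) (t₀₁t₁₂t₀₁ n))
      (actsAs-conjugate generator-q (actsAs-generator (1 + q)))

  w₂₄ : List ℕ
  w₂₄ = w₃₄ ++ w₂₃ ++ w₃₄

  w₂₄-pure : PureTransposition w₂₄ (2 + q) (4 + q)
  w₂₄-pure = pure-resp (transpose-mismatch (≢-shift 2 3) (≢-shift 2 4)) (transpose-matchˡ (3 + q) (4 + q))
                       (conjugate-by-transposition w₃₄-pure w₂₃-pure)

  w₁₂ : List ℕ
  w₁₂ = w₁₄ ++ w₂₄ ++ w₁₄

  w₁₂-labels : LabelsFrom q w₁₂
  w₁₂-labels = ++⁺ w₁₄-labels (++⁺ (++⁺ w₃₄-labels (++⁺ w₂₃-labels w₃₄-labels)) w₁₄-labels)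

  w₁₂-pure : PureTransposition w₁₂ (1 + q) (2 + q)
  w₁₂-pure = pure-sym (pure-resp (transpose-mismatch (≢-shift 2 1) (≢-shift 2 4)) (transpose-matchʳ (1 + q) (4 + q))
                                 (conjugate-by-transposition w₁₄-pure w₂₄-pure))

  toTop : ℕ → ℕ → List ℕ
  toTop k zero    = w₁₄
  toTop k (suc d) = k ∷ toTop (suc k) d ++ k ∷ []

  toTop-pure : ∀ d k → d + k ≡ 1 + q → PureTransposition (toTop k d) k (4 + q)
  toTop-pure zero    k refl = w₁₄-pure
  toTop-pure (suc d) k d+k≡q =
    pure-resp (actA-at-suc-l k) (actA-fixes-above (<⇒≢ k<1+q) (s≤s (≤-trans k<1+q (m≤n+m _ 2))))
              (conjugate-by-generator k (toTop-pure d (suc k) (trans (+-suc d k) d+k≡q)))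
    where
    k<1+q : k < 1 + q
    k<1+q = subst (k <_) d+k≡q (s≤s (m≤n+m k d))

  toTop-labels : ∀ d k → d + k ≡ 1 + q → LabelsFrom k (toTop k d)
  toTop-labels zero    k refl = (≤-refl , n≤1+n _) ∷ (n≤1+n _ , ≤-refl) ∷ (≤-refl , n≤1+n _) ∷ []
  toTop-labels (suc d) k d+k≡q =
    ++⁺ (here-label ∷ All.map (λ (k<j , j≤) → <⇒≤ k<j , j≤) (toTop-labels d (suc k) (trans (+-suc d k) d+k≡q)))
        (here-label ∷ [])
    where
    here-label : k ≤ k × k ≤ 2 + q
    here-label = ≤-refl , ≤-trans (subst (k ≤_) d+k≡q (m≤n+m k (suc d))) (n≤1+n _)

  -- (k k+1) = (k q+4) (k+1 q+4) (k q+4)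
  lowAdjacent : ℕ → List ℕ
  lowAdjacent k = toTop k (suc (q ∸ k)) ++ toTop (suc k) (q ∸ k) ++ toTop k (suc (q ∸ k))

  module _ {k} (k≤q : k ≤ q) where
    private
      from-k : suc (q ∸ k) + k ≡ 1 + q
      from-k = cong suc (m∸n+n≡m k≤q)
      from-k+1 : q ∸ k + suc k ≡ 1 + q
      from-k+1 = trans (+-suc (q ∸ k) k) from-k

    lowAdjacent-pure : PureTransposition (lowAdjacent k) k (suc k)
    lowAdjacent-pure =
      pure-sym (pure-resp (transpose-mismatch (≢-sym (<⇒≢ (n<1+n k))) (<⇒≢ (s≤s (s≤s (≤-trans k≤q (m≤n+m q 2))))))
                          (transpose-matchʳ k (4 + q))
                          (conjugate-by-transposition (toTop-pure _ k from-k) (toTop-pure _ (suc k) from-k+1)))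

    lowAdjacent-labels : LabelsFrom k (lowAdjacent k)
    lowAdjacent-labels =
      ++⁺ (toTop-labels _ k from-k)
          (++⁺ (All.map (λ (k<j , j≤) → <⇒≤ k<j , j≤) (toTop-labels _ (suc k) from-k+1)) (toTop-labels _ k from-k))

  from-q : ∀ {k w} → q ≤ k → LabelsFrom q w → LabelsFrom (k ⊓ q) w
  from-q {w = w} q≤k = subst (λ m → LabelsFrom m w) (sym (m≥n⇒m⊓n≡n q≤k))

  pure-adjacent : ∀ k → k ≤ 3 + q → Σ[ w ∈ List ℕ ] PureTransposition w k (suc k) × LabelsFrom (k ⊓ q) w
  pure-adjacent k k≤3+q with k ≤? q
  ... | yes k≤q = lowAdjacent k , lowAdjacent-pure k≤q
                , subst (λ m → LabelsFrom m (lowAdjacent k)) (sym (m≤n⇒m⊓n≡m k≤q)) (lowAdjacent-labels k≤q)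
  ... | no k≰q with m≤n⇒m<n∨m≡n k≤3+q
  ...   | inj₂ refl = w₃₄ , w₃₄-pure , from-q (m≤n+m q 3) w₃₄-labels
  ...   | inj₁ k<3+q with m≤n⇒m<n∨m≡n (≤-pred k<3+q)
  ...     | inj₂ refl = w₂₃ , w₂₃-pure , from-q (m≤n+m q 2) w₂₃-labels
  ...     | inj₁ k<2+q with ≤-antisym (≤-pred k<2+q) (≰⇒> k≰q)
  ...       | refl = w₁₂ , w₁₂-pure , from-q (n≤1+n q) w₁₂-labels

  pure-word : ∀ (Q : ℕ → Set) {ks} → All (λ k → k ≤ 3 + q × (∀ {j} → k ⊓ q ≤ j → j ≤ 2 + q → Q j)) ks →
              Σ[ w ∈ List ℕ ] ActsAs w (Adjacent.eval ks) id × All (λ j → Q j × j ≤ 2 + q) w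
  pure-word Q []                 = [] , actsAs (λ _ → refl) (λ _ → refl) , []
  pure-word Q {k ∷ _} ((k≤3+q , Q-from) ∷ rest) with pure-adjacent k k≤3+q | pure-word Q rest
  ... | w , w-pure , w-labels | v , v-acts , v-labels =
    w ++ v , actsAs-++ w-pure v-acts , ++⁺ (All.map (λ (lo≤j , j≤) → Q-from lo≤j j≤ , j≤) w-labels) v-labels

module Generation (q : ℕ) where
  open Action q
  open Parabolics q
  open PureWords q

  record WordFor (P : ℕ → Set) (α β : ℕ → ℕ) : Set where
    field
      word    : List ℕ
      allowed : All (λ j → P j × j ≤ 2 + q) word
      onA     : A.eval word ≈ᴬ α
      onB     : B.eval word ≈ᴮ β

  data PointView : ℕ → Set where
    low : ∀ {n} → n ≤ q → PointView n
    at₁ : PointView (1 + q)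
    at₂ : PointView (2 + q)
    at₃ : PointView (3 + q)
    at₄ : PointView (4 + q)

  pointView : ∀ {n} → n < 5 + q → PointView n
  pointView {n} n<5+q with n ≤? q
  ... | yes n≤q = low n≤q
  ... | no n≰q with m<1+n⇒m<n∨m≡n n<5+q
  ...   | inj₂ refl = at₄
  ...   | inj₁ n<4+q with m<1+n⇒m<n∨m≡n n<4+q
  ...     | inj₂ refl = at₃
  ...     | inj₁ n<3+q with m<1+n⇒m<n∨m≡n n<3+q
  ...       | inj₂ refl = at₂
  ...       | inj₁ n<2+q with ≤-antisym (≤-pred n<2+q) (≰⇒> n≰q)
  ...         | refl = at₁

  FixesUpTo : ℕ → (ℕ → ℕ) → Set
  FixesUpTo k α = ∀ {m} → m ≤ k → α m ≡ m

  fixes-outside-34 : ∀ {f} → FixesUpTo (2 + q) f → ∀ {n} → n < 5 + q → n ≢ 3 + q → n ≢ 4 + q → f n ≡ n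
  fixes-outside-34 fix n<5+q n≢3+q n≢4+q with pointView n<5+q
  ... | low n≤q = fix (≤-trans n≤q (m≤n+m q 2))
  ... | at₁ = fix (n≤1+n _)
  ... | at₂ = fix ≤-refl
  ... | at₃ = ⊥-elim (n≢3+q refl)
  ... | at₄ = ⊥-elim (n≢4+q refl)

  fixes-outside-3 : ∀ {f} → FixesUpTo (2 + q) f → f (4 + q) ≡ 4 + q → ∀ {n} → n < 5 + q → n ≢ 3 + q → f n ≡ n
  fixes-outside-3 fix f4≡4 {n} n<5+q n≢3+q with n ≟ 4 + q
  ... | yes refl   = f4≡4
  ... | no n≢4+q  = fixes-outside-34 fix n<5+q n≢3+q n≢4+q

  fixes-outside-23 : ∀ {f} → FixesUpTo q f → f (1 + q) ≡ 1 + q → f (4 + q) ≡ 4 + q →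
                     ∀ {n} → n < 5 + q → n ≢ 2 + q → n ≢ 3 + q → f n ≡ n
  fixes-outside-23 fix f1≡1 f4≡4 n<5+q n≢2+q n≢3+q with pointView n<5+q
  ... | low n≤q = fix n≤q
  ... | at₁ = f1≡1
  ... | at₂ = ⊥-elim (n≢2+q refl)
  ... | at₃ = ⊥-elim (n≢3+q refl)
  ... | at₄ = f4≡4

  module Pure (P : ℕ → Set) (P? : Decidable P) {α γ} (π : PermutationOn (5 + q) α γ)
              (parabolic : ∀ {k} → k ≤ 2 + q → ¬ P k → Parabolic k α id) where
    open PermutationOn π

    Labelled : List ℕ → Set
    Labelled = All (λ j → P j × j ≤ 2 + q)

    fixes-up-to : ∀ {k} → k ≤ 2 + q → ¬ P k → FixesUpTo k α
    fixes-up-to k≤2+q ¬Pk m≤k = sym (proj₂ (Parabolic.lower (parabolic k≤2+q ¬Pk) m≤k))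

    undo : ∀ {δ : ℕ → ℕ} (f : ℕ → ℕ) → PermutationOn (5 + q) δ δ → α ∘ δ ≈ᴬ f → α ≈ᴬ f ∘ δ
    undo f δ-perm αδ≗f n<5+q = trans (cong α (sym (Δ.inverseˡ n<5+q))) (αδ≗f (Δ.f-< n<5+q))
      where module Δ = PermutationOn δ-perm

    -- α ∘ δ fixes everything but x and y, so it is the identity or (x y).
    realise : ∀ {v δ w x y} → ActsAs v δ id → PermutationOn (5 + q) δ δ → Labelled v →
              PureTransposition w x y → Labelled w → x < 5 + q → y < 5 + q → x ≢ y →
              (∀ {n} → n < 5 + q → n ≢ x → n ≢ y → α (δ n) ≡ n) → WordFor P α id
    realise {v} {δ} {w} {x} {y} v-acts δ-perm v-allowed w-pure w-allowed x<5+q y<5+q x≢y fixes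
      with fixes-all-but-two (permutationOn-∘ π δ-perm) x<5+q y<5+q x≢y fixes
    ... | inj₁ αδ≗id = record
      { word = v ; allowed = v-allowed
      ; onA  = λ {n} n< → trans (ActsAs.onA v-acts n) (sym (undo id δ-perm αδ≗id n<))
      ; onB  = λ {n} _ → ActsAs.onB v-acts n
      }
    ... | inj₂ αδ≗t = record
      { word = w ++ v ; allowed = ++⁺ w-allowed v-allowed
      ; onA  = λ {n} n< → trans (ActsAs.onA (actsAs-++ w-pure v-acts) n) (sym (undo (transpose x y) δ-perm αδ≗t n<))
      ; onB  = λ {n} _ → ActsAs.onB (actsAs-++ w-pure v-acts) n
      }

    realise₀ : ∀ {w x y} → PureTransposition w x y → Labelled w → x < 5 + q → y < 5 + q → x ≢ y →
               (∀ {n} → n < 5 + q → n ≢ x → n ≢ y → α n ≡ n) → WordFor P α id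
    realise₀ = realise (actsAs (λ _ → refl) (λ _ → refl)) permutationOn-id []

    identity : α ≈ᴬ id → WordFor P α id
    identity α≗id = record { word = [] ; allowed = [] ; onA = sym ∘ α≗id ; onB = λ _ → refl }

    square-top : ¬ P q → α (1 + q) ≡ 1 + q → α (4 + q) ≡ 4 + q
    square-top ¬P₀ α1≡1 with square-fixing-B (Parabolic.square (parabolic (m≤n+m q 2) ¬P₀) refl)
    ... | inj₁ (_ , α4≡4)  = α4≡4
    ... | inj₂ (α1≡4 , _) = ⊥-elim (≢-shift 1 4 (trans (sym α1≡1) α1≡4))

    case-no-2+q : ¬ P (2 + q) → WordFor P α id
    case-no-2+q ¬P₂ with P? (1 + q) | P? q
    ... | no ¬P₁ | _      = identity (fixes-all-but-one π (fixes-outside-3 fix₂ (Parabolic.top (parabolic (n≤1+n _) ¬P₁) refl)))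
      where fix₂ = fixes-up-to ≤-refl ¬P₂
    ... | yes _  | no ¬P₀ = identity (fixes-all-but-one π (fixes-outside-3 fix₂ (square-top ¬P₀ (fix₂ (n≤1+n _)))))
      where fix₂ = fixes-up-to ≤-refl ¬P₂
    ... | yes P₁ | yes P₀ = realise₀ w₃₄-pure (p₁ ∷ p₀ ∷ p₁ ∷ p₀ ∷ p₁ ∷ p₀ ∷ []) (<-shift 3 5) (<-shift 4 5) (≢-shift 3 4)
                                     (fixes-outside-34 (fixes-up-to ≤-refl ¬P₂))
      where p₀ = P₀ , m≤n+m q 2 ; p₁ = P₁ , n≤1+n _

    case-no-1+q : P (2 + q) → ¬ P (1 + q) → WordFor P α id
    case-no-1+q P₂ ¬P₁ = realise₀ w₂₃-pure ((P₂ , ≤-refl) ∷ []) (<-shift 2 5) (<-shift 3 5) (≢-shift 2 3)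
                           (fixes-outside-23 (fix₁ ∘ m≤n⇒m≤1+n) (fix₁ ≤-refl) (Parabolic.top (parabolic (n≤1+n _) ¬P₁) refl))
      where fix₁ = fixes-up-to (n≤1+n _) ¬P₁

    case-no-q : P (2 + q) → P (1 + q) → ¬ P q → WordFor P α id
    case-no-q P₂ P₁ ¬P₀ with square-fixing-B (Parabolic.square (parabolic (m≤n+m q 2) ¬P₀) refl)
    ... | inj₁ (α1≡1 , α4≡4) = realise₀ w₂₃-pure ((P₂ , ≤-refl) ∷ []) (<-shift 2 5) (<-shift 3 5) (≢-shift 2 3)
                                  (fixes-outside-23 (fixes-up-to (m≤n+m q 2) ¬P₀) α1≡1 α4≡4)
    ... | inj₂ (α1≡4 , α4≡1) =
      realise w₁₄-pure (transpose-permutationOn (<-shift 1 5) (<-shift 4 5)) (p₁ ∷ (P₂ , ≤-refl) ∷ p₁ ∷ [])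
              w₂₃-pure ((P₂ , ≤-refl) ∷ []) (<-shift 2 5) (<-shift 3 5) (≢-shift 2 3)
              (fixes-outside-23 fix₀ (trans (cong α (transpose-matchˡ (1 + q) (4 + q))) α4≡1)
                                     (trans (cong α (transpose-matchʳ (1 + q) (4 + q))) α1≡4))
      where
      p₁ = P₁ , n≤1+n _
      fix₀ : FixesUpTo q (α ∘ transpose (1 + q) (4 + q))
      fix₀ m≤q = trans (cong α (transpose-mismatch (<⇒≢ (s≤s m≤q)) (<⇒≢ (≤-trans (s≤s m≤q) (m≤n+m _ 3)))))
                       (fixes-up-to (m≤n+m q 2) ¬P₀ m≤q)

    AllFrom : ℕ → Set
    AllFrom k = ∀ {j} → k ≤ j → j ≤ 2 + q → P j

    allFrom-q : P (2 + q) → P (1 + q) → P q → AllFrom q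
    allFrom-q P₂ P₁ P₀ q≤j j≤2+q with m≤n⇒m<n∨m≡n j≤2+q
    ... | inj₂ refl = P₂
    ... | inj₁ j<2+q with m≤n⇒m<n∨m≡n (≤-pred j<2+q)
    ...   | inj₂ refl = P₁
    ...   | inj₁ j<1+q with ≤-antisym (≤-pred j<1+q) q≤j
    ...     | refl = P₀

    allFrom-or-fixes : AllFrom q → ∀ d {k} → d + k ≡ q → AllFrom k ⊎ FixesUpTo k α
    allFrom-or-fixes all-q zero    refl = inj₁ all-q
    allFrom-or-fixes all-q (suc d) {k} d+k≡q with allFrom-or-fixes all-q d (trans (+-suc d k) d+k≡q)
    ... | inj₂ fix = inj₂ (fix ∘ m≤n⇒m≤1+n)
    ... | inj₁ all with P? k
    ...   | no ¬Pk = inj₂ (fixes-up-to (≤-trans k≤q (m≤n+m q 2)) ¬Pk)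
      where k≤q = subst (k ≤_) d+k≡q (m≤n+m k (suc d))
    ...   | yes Pk = inj₁ all′
      where
      all′ : AllFrom k
      all′ {j} k≤j j≤2+q with j ≟ k
      ... | yes refl = Pk
      ... | no j≢k   = all (≤∧≢⇒< k≤j (≢-sym j≢k)) j≤2+q

    module _ (all-q : AllFrom q) where
      Allowed : ℕ → Set
      Allowed k = k ≤ q → AllFrom k

      -- The transposition (k k+1) is only needed when α moves a point of [0, k], and then every
      -- label from k on is available.
      split : ∀ k → suc k < 5 + q → Allowed k ⊎ (PreservesUpTo k α × PreservesUpTo k γ)
      split k k+1<5+q with k ≤? q
      ... | no k≰q = inj₁ (λ k≤q → ⊥-elim (k≰q k≤q))
      ... | yes k≤q with allFrom-or-fixes all-q (q ∸ k) (m∸n+n≡m k≤q)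
      ...   | inj₁ all = inj₁ (λ _ → all)
      ...   | inj₂ fix = inj₂ ( (λ m≤k → subst (_≤ k) (sym (fix m≤k)) m≤k)
                              , (λ m≤k → subst (_≤ k) (sym (γ-fixes m≤k)) m≤k) )
        where
        γ-fixes : ∀ {m} → m ≤ k → γ m ≡ m
        γ-fixes m≤k = trans (cong γ (sym (fix m≤k))) (inverseˡ (<-trans (s≤s m≤k) k+1<5+q))

      allFrom-min : ∀ {k} → Allowed k → ∀ {j} → k ⊓ q ≤ j → j ≤ 2 + q → P j
      allFrom-min {k} allowed {j} min≤j with k ≤? q
      ... | yes k≤q = allowed k≤q (subst (_≤ j) (m≤n⇒m⊓n≡m k≤q) min≤j)
      ... | no k≰q  = all-q (subst (_≤ j) (m≥n⇒m⊓n≡n (<⇒≤ (≰⇒> k≰q))) min≤j)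

      module F = AdjacentFactorisation (adjacent-factorisation (5 + q) Allowed π split)

      realise-sorted : WordFor P α id
      realise-sorted = record
        { word    = proj₁ w
        ; allowed = proj₂ (proj₂ w)
        ; onA     = λ {n} n< → trans (ActsAs.onA (proj₁ (proj₂ w)) n) (F.evaluates n<)
        ; onB     = λ {n} _ → ActsAs.onB (proj₁ (proj₂ w)) n
        }
        where
        w = pure-word P (All.map (λ (allowed , k+1<5+q) → ≤-pred (≤-pred k+1<5+q) , λ {j} → allFrom-min allowed {j})
                                 F.allowed)

    word-for : WordFor P α id
    word-for with P? (2 + q) | P? (1 + q) | P? q
    ... | no ¬P₂ | _      | _      = case-no-2+q ¬P₂
    ... | yes P₂ | no ¬P₁ | _      = case-no-1+q P₂ ¬P₁
    ... | yes P₂ | yes P₁ | no ¬P₀ = case-no-q P₂ P₁ ¬P₀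
    ... | yes P₂ | yes P₁ | yes P₀ = realise-sorted (allFrom-q P₂ P₁ P₀)

  module SortB (P : ℕ → Set) (P? : Decidable P) {α γ β δ}
               (πα : PermutationOn (5 + q) α γ) (πβ : PermutationOn (3 + q) β δ)
               (parabolic : ∀ {k} → k ≤ 2 + q → ¬ P k → Parabolic k α β × Parabolic k γ δ) where

    bound : ∀ {k} → suc k < 3 + q → k ≤ 2 + q
    bound = <⇒≤ ∘ ≤-pred

    split : ∀ k → suc k < 3 + q → P k ⊎ (PreservesUpTo k β × PreservesUpTo k δ)
    split k k+1<3+q with P? k
    ... | yes Pk  = inj₁ Pk
    ... | no ¬Pk = inj₂ (Parabolic.preserves-β (proj₁ p) , Parabolic.preserves-β (proj₂ p))
      where p = parabolic (bound k+1<3+q) ¬Pk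

    module F = AdjacentFactorisation (adjacent-factorisation (3 + q) P πβ split)

    F-labels : All (λ j → j ≤ 2 + q) F.word
    F-labels = All.map (bound ∘ proj₂) F.allowed

    B-sorts : B.eval F.word ≈ᴮ β
    B-sorts {n} n< = trans (eval-cong (λ (_ , k+1<3+q) → actB-adjacent (≤-pred (≤-pred k+1<3+q))) F.allowed n)
                           (F.evaluates n<)

    α′ γ′ β′ : ℕ → ℕ
    α′ = A.eval (reverse F.word) ∘ α
    γ′ = γ ∘ A.eval F.word
    β′ = B.eval (reverse F.word) ∘ β

    β′≈id : β′ ≈ᴮ id
    β′≈id {n} n< = trans (cong (B.eval (reverse F.word)) (sym (B-sorts n<)))
                         (B.eval-reverse-inverseˡ actB-involutive F.word n)

    π′ : PermutationOn (5 + q) α′ γ′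
    π′ = permutationOn-∘ (permutationOn-sym (A.eval-permutationOn actA-involutive actA-< F-labels)) πα

    parabolic′ : ∀ {k} → k ≤ 2 + q → ¬ P k → Parabolic k α′ id
    parabolic′ k≤2+q ¬Pk =
      parabolic-resp k≤2+q (λ _ → refl) β′≈id
        (parabolic-eval k≤2+q (All-reverse (All.map (λ (Pj , j+1<3+q) → bound j+1<3+q , λ { refl → ¬Pk Pj }) F.allowed))
                        (proj₁ (parabolic k≤2+q ¬Pk)))

  generate : ∀ (P : ℕ → Set) → Decidable P → ∀ {α γ β δ} →
             PermutationOn (5 + q) α γ → PermutationOn (3 + q) β δ →
             (∀ {k} → k ≤ 2 + q → ¬ P k → Parabolic k α β × Parabolic k γ δ) → WordFor P α β
  generate P P? {α} {β = β} πα πβ parabolic = record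
    { word    = F.word ++ U.word
    ; allowed = ++⁺ (All.map (λ (Pk , k+1<3+q) → Pk , bound k+1<3+q) F.allowed) U.allowed
    ; onA     = λ {n} n< → begin
        A.eval (F.word ++ U.word) n     ≡⟨ A.eval-++ F.word U.word n ⟩
        A.eval F.word (A.eval U.word n) ≡⟨ cong (A.eval F.word) (U.onA n<) ⟩
        A.eval F.word (α′ n)            ≡⟨ A.eval-reverse-inverseʳ actA-involutive F.word (α n) ⟩
        α n                             ∎
    ; onB     = λ {n} n< → begin
        B.eval (F.word ++ U.word) n     ≡⟨ B.eval-++ F.word U.word n ⟩
        B.eval F.word (B.eval U.word n) ≡⟨ cong (B.eval F.word) (U.onB n<) ⟩
        B.eval F.word n                 ≡⟨ B-sorts n< ⟩
        β n                             ∎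
    }
    where
    open SortB P P? πα πβ parabolic
    module U = WordFor (Pure.word-for P P? π′ parabolic′)

module Representation (q : ℕ) where
  open Action q

  r : ℕ
  r = 3 + q

  open Graph (vtx-≟ r) (𝒢 r) using (ρ; WellFormed)

  data EdgeOf𝒢 (l : ℕ) : Vtx r → Vtx r → Set where
    pathA : ∀ (a b : Fin (5 + q)) → toℕ a ≡ l → toℕ b ≡ suc l → l ≤ 2 + q → EdgeOf𝒢 l (inj₁ a) (inj₁ b)
    extra : ∀ (a b : Fin (5 + q)) → toℕ a ≡ 3 + q → toℕ b ≡ 4 + q → l ≡ 1 + q → EdgeOf𝒢 l (inj₁ a) (inj₁ b)
    pathB : ∀ (a b : Fin r) → toℕ a ≡ l → toℕ b ≡ suc l → l ≤ 1 + q → EdgeOf𝒢 l (inj₂ a) (inj₂ b)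

  pathsA extraEdge pathsB : List (Edge (Vtx r))
  pathsA    = map (mapEdge (inj₁ ∘ inject₁)) (pathEdges (suc r))
  extraEdge = (r ∸ 2 , inj₁ (inject₁ (fromℕ r)) , inj₁ (fromℕ (suc r))) ∷ []
  pathsB    = map (mapEdge inj₂) (pathEdges r)

  classify : ∀ {l c d} → (l , c , d) ∈ 𝒢 r → EdgeOf𝒢 l c d
  classify e∈ with ∈-++⁻ pathsA {extraEdge ++ pathsB} e∈
  ... | inj₁ e∈A with ∈-map⁻ _ e∈A
  ...   | (_ , a , b) , e′∈ , refl with ∈-pathEdges⁻ (suc r) e′∈
  ...     | a≡l , b≡1+l = pathA (inject₁ a) (inject₁ b) (trans (toℕ-inject₁ a) a≡l) (trans (toℕ-inject₁ b) b≡1+l)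
                                (≤-pred (≤-pred (subst (_< 4 + q) b≡1+l (toℕ<n b))))
  classify e∈ | inj₂ e∈rest with ∈-++⁻ extraEdge {pathsB} e∈rest
  ... | inj₁ (here refl) = extra _ _ (trans (toℕ-inject₁ (fromℕ r)) (toℕ-fromℕ r)) (toℕ-fromℕ (suc r)) refl
  ... | inj₂ e∈B with ∈-map⁻ _ e∈B
  ...   | (_ , a , b) , e′∈ , refl with ∈-pathEdges⁻ r e′∈
  ...     | a≡l , b≡1+l = pathB a b a≡l b≡1+l (≤-pred (≤-pred (subst (_< 3 + q) b≡1+l (toℕ<n b))))

  edgeA : ∀ l → l ≤ 2 + q → Σ[ a ∈ Fin (5 + q) ] Σ[ b ∈ Fin (5 + q) ]
          (l , inj₁ a , inj₁ b) ∈ 𝒢 r × toℕ a ≡ l × toℕ b ≡ suc l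
  edgeA l l≤2+q with ∈-pathEdges⁺ (suc r) l (s≤s (s≤s l≤2+q))
  ... | a , b , e∈ , a≡l , b≡1+l =
    inject₁ a , inject₁ b , ∈-++⁺ˡ {xs = pathsA} {ys = extraEdge ++ pathsB} (∈-map⁺ (mapEdge (inj₁ ∘ inject₁)) e∈)
    , trans (toℕ-inject₁ a) a≡l , trans (toℕ-inject₁ b) b≡1+l

  edgeExtra : Σ[ a ∈ Fin (5 + q) ] Σ[ b ∈ Fin (5 + q) ]
              (1 + q , inj₁ a , inj₁ b) ∈ 𝒢 r × toℕ a ≡ 3 + q × toℕ b ≡ 4 + q
  edgeExtra = inject₁ (fromℕ r) , fromℕ (suc r) , ∈-++⁺ʳ pathsA (∈-++⁺ˡ {xs = extraEdge} {ys = pathsB} (here refl))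
            , trans (toℕ-inject₁ (fromℕ r)) (toℕ-fromℕ r) , toℕ-fromℕ (suc r)

  edgeB : ∀ l → l ≤ 1 + q → Σ[ a ∈ Fin r ] Σ[ b ∈ Fin r ]
          (l , inj₂ a , inj₂ b) ∈ 𝒢 r × toℕ a ≡ l × toℕ b ≡ suc l
  edgeB l l≤1+q with ∈-pathEdges⁺ r l (s≤s (s≤s l≤1+q))
  ... | a , b , e∈ , a≡l , b≡1+l =
    a , b , ∈-++⁺ʳ pathsA (∈-++⁺ʳ extraEdge (∈-map⁺ (mapEdge inj₂) e∈)) , a≡l , b≡1+l

  label≤ : (i : Fin r) → toℕ i ≤ 2 + q
  label≤ i = ≤-pred (toℕ<n i)

  σ : Fin r → Vtx r → Vtx r
  σ i (inj₁ x) = inj₁ (restrict (actA (toℕ i)) (actA-< (label≤ i)) x)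
  σ i (inj₂ x) = inj₂ (restrict (actB (toℕ i)) (actB-< (label≤ i)) x)

  σ-inj₁ : ∀ i {x y} → actA (toℕ i) (toℕ x) ≡ toℕ y → σ i (inj₁ x) ≡ inj₁ y
  σ-inj₁ i {x} e = cong inj₁ (toℕ-injective (trans (toℕ-restrict (actA (toℕ i)) (actA-< (label≤ i)) x) e))

  σ-inj₂ : ∀ i {x y} → actB (toℕ i) (toℕ x) ≡ toℕ y → σ i (inj₂ x) ≡ inj₂ y
  σ-inj₂ i {x} e = cong inj₂ (toℕ-injective (trans (toℕ-restrict (actB (toℕ i)) (actB-< (label≤ i)) x) e))

  σ-edge : ∀ i {c d} → (toℕ i , c , d) ∈ 𝒢 r → σ i c ≡ d × σ i d ≡ c
  σ-edge i e∈ with classify e∈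
  ... | pathA a b a≡l b≡1+l _ =
      σ-inj₁ i (trans (cong (actA _) a≡l) (trans (actA-at-l _) (sym b≡1+l)))
    , σ-inj₁ i (trans (cong (actA _) b≡1+l) (trans (actA-at-suc-l _) (sym a≡l)))
  ... | extra a b a≡3+q b≡4+q l≡1+q =
      σ-inj₁ i (trans (cong₂ actA l≡1+q a≡3+q) (trans actA-1+q-at-3+q (sym b≡4+q)))
    , σ-inj₁ i (trans (cong₂ actA l≡1+q b≡4+q) (trans actA-1+q-at-4+q (sym a≡3+q)))
  ... | pathB a b a≡l b≡1+l l≤1+q =
      σ-inj₂ i (trans (cong (actB _) a≡l) (trans (actB-at-l l≤1+q) (sym b≡1+l)))
    , σ-inj₂ i (trans (cong (actB _) b≡1+l) (trans (actB-at-suc-l l≤1+q) (sym a≡l)))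

  OnEdge : ℕ → Vtx r → Set
  OnEdge l v = ∃₂ λ c d → (l , c , d) ∈ 𝒢 r × (v ≡ c ⊎ v ≡ d)

  σ-moves : ∀ i v → σ i v ≢ v → OnEdge (toℕ i) v
  σ-moves i (inj₁ x) moved with actA-moves (moved ∘ σ-inj₁ i)
  ... | inj₁ (inj₁ x≡l) with edgeA (toℕ i) (label≤ i)
  ...   | a , b , e∈ , a≡l , _ = _ , _ , e∈ , inj₁ (cong inj₁ (toℕ-injective (trans x≡l (sym a≡l))))
  σ-moves i (inj₁ x) moved | inj₁ (inj₂ x≡1+l) with edgeA (toℕ i) (label≤ i)
  ...   | a , b , e∈ , _ , b≡1+l = _ , _ , e∈ , inj₂ (cong inj₁ (toℕ-injective (trans x≡1+l (sym b≡1+l))))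
  σ-moves i (inj₁ x) moved | inj₂ (l≡1+q , x≡3+q⊎x≡4+q) with edgeExtra
  ...   | a , b , e∈ , a≡3+q , b≡4+q =
    _ , _ , subst (λ l → (l , _ , _) ∈ 𝒢 r) (sym l≡1+q) e∈ , at-end x≡3+q⊎x≡4+q
    where
    at-end : toℕ x ≡ 3 + q ⊎ toℕ x ≡ 4 + q → inj₁ x ≡ inj₁ a ⊎ inj₁ x ≡ inj₁ b
    at-end (inj₁ x≡3+q) = inj₁ (cong inj₁ (toℕ-injective (trans x≡3+q (sym a≡3+q))))
    at-end (inj₂ x≡4+q) = inj₂ (cong inj₁ (toℕ-injective (trans x≡4+q (sym b≡4+q))))
  σ-moves i (inj₂ x) moved with actB-moves (moved ∘ σ-inj₂ i)
  ... | l≢2+q , x≡l⊎x≡1+l with edgeB (toℕ i) (≤-pred (≤∧≢⇒< (label≤ i) l≢2+q))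
  ...   | a , b , e∈ , a≡l , b≡1+l = _ , _ , e∈ , at-end x≡l⊎x≡1+l
    where
    at-end : toℕ x ≡ toℕ i ⊎ toℕ x ≡ suc (toℕ i) → inj₂ x ≡ inj₂ a ⊎ inj₂ x ≡ inj₂ b
    at-end (inj₁ x≡l)   = inj₁ (cong inj₂ (toℕ-injective (trans x≡l (sym a≡l))))
    at-end (inj₂ x≡1+l) = inj₂ (cong inj₂ (toℕ-injective (trans x≡1+l (sym b≡1+l))))

  ρ≡σ : ∀ i v → ρ (toℕ i) v ≡ σ i v
  ρ≡σ i v = ρ-unique (vtx-≟ r) (𝒢 r) (toℕ i) v (σ i v)
    (λ e∈ → (λ { refl → sym (proj₁ (σ-edge i e∈)) }) , (λ { refl → sym (proj₂ (σ-edge i e∈)) }))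
    off-edges
    where
    off-edges : (∀ {c d} → (toℕ i , c , d) ∈ 𝒢 r → v ≢ c × v ≢ d) → v ≡ σ i v
    off-edges off with vtx-≟ r (σ i v) v
    ... | yes σv≡v = sym σv≡v
    ... | no moved with σ-moves i v moved
    ...   | _ , _ , e∈ , inj₁ v≡c = ⊥-elim (proj₁ (off e∈) v≡c)
    ...   | _ , _ , e∈ , inj₂ v≡d = ⊥-elim (proj₂ (off e∈) v≡d)

  -- The edges of label l are 2-cycles of the involution σ l, so two of them that meet coincide.
  well-formed : WellFormed r
  well-formed =
    bounded , (λ ab∈ cd∈ → two-cycles (σ (label ab∈)) (σ-edge′ ab∈ ab∈) (σ-edge′ ab∈ cd∈)) , labelled
    where
    bounded : ∀ {l a b} → (l , a , b) ∈ 𝒢 r → l < r × a ≢ b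
    bounded e∈ with classify e∈
    ... | pathA a b a≡l b≡1+l l≤2+q = s≤s l≤2+q , λ { refl → 1+n≢n (trans (sym b≡1+l) a≡l) }
    ... | extra a b a≡3+q b≡4+q refl = <-shift 1 3 , λ { refl → 1+n≢n (trans (sym b≡4+q) a≡3+q) }
    ... | pathB a b a≡l b≡1+l l≤1+q = s≤s (m≤n⇒m≤1+n l≤1+q) , λ { refl → 1+n≢n (trans (sym b≡1+l) a≡l) }
    label : ∀ {l a b} → (l , a , b) ∈ 𝒢 r → Fin r
    label e∈ = fromℕ< (proj₁ (bounded e∈))
    σ-edge′ : ∀ {l a b c d} (ab∈ : (l , a , b) ∈ 𝒢 r) → (l , c , d) ∈ 𝒢 r →
              σ (label ab∈) c ≡ d × σ (label ab∈) d ≡ c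
    σ-edge′ ab∈ cd∈ = σ-edge (label ab∈) (subst (λ l → (l , _ , _) ∈ 𝒢 r) (sym (toℕ-fromℕ< _)) cd∈)
    labelled : ∀ (l : Fin r) → ∃₂ λ a b → (toℕ l , a , b) ∈ 𝒢 r
    labelled l = let a , b , e∈ , _ = edgeA (toℕ l) (label≤ l) in inj₁ a , inj₁ b , e∈

  module G = Generated (ρs (vtx-≟ r) r (𝒢 r))

  labels : G.Word → List ℕ
  labels = map toℕ

  labels≤ : ∀ w → All (_≤ 2 + q) (labels w)
  labels≤ []      = []
  labels≤ (i ∷ w) = label≤ i ∷ labels≤ w

  permutationA : ∀ w → PermutationOn (5 + q) (A.eval (labels w)) (A.eval (reverse (labels w)))
  permutationA w = A.eval-permutationOn actA-involutive actA-< (labels≤ w)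

  permutationB : ∀ w → PermutationOn (3 + q) (B.eval (labels w)) (B.eval (reverse (labels w)))
  permutationB w = B.eval-permutationOn actB-involutive actB-< (labels≤ w)

  actionA : G.Word → Permutation′ (5 + q)
  actionA = toPermutation ∘ permutationA

  actionB : G.Word → Permutation′ r
  actionB = toPermutation ∘ permutationB

  eval-inj₁ : ∀ w x → G.eval w (inj₁ x) ≡ inj₁ (actionA w ⟨$⟩ʳ x)
  eval-inj₁ []      x = cong inj₁ (sym (fromℕ<-toℕ x _))
  eval-inj₁ (i ∷ w) x = begin
    ρ (toℕ i) (G.eval w (inj₁ x))      ≡⟨ cong (ρ (toℕ i)) (eval-inj₁ w x) ⟩
    ρ (toℕ i) (inj₁ (actionA w ⟨$⟩ʳ x)) ≡⟨ ρ≡σ i _ ⟩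
    σ i (inj₁ (actionA w ⟨$⟩ʳ x))       ≡⟨ σ-inj₁ i (trans (cong (actA (toℕ i)) (toℕ-toPermutation (permutationA w) x))
                                                        (sym (toℕ-toPermutation (permutationA (i ∷ w)) x))) ⟩
    inj₁ (actionA (i ∷ w) ⟨$⟩ʳ x)       ∎
    where open ≡-Reasoning

  eval-inj₂ : ∀ w x → G.eval w (inj₂ x) ≡ inj₂ (actionB w ⟨$⟩ʳ x)
  eval-inj₂ []      x = cong inj₂ (sym (fromℕ<-toℕ x _))
  eval-inj₂ (i ∷ w) x = begin
    ρ (toℕ i) (G.eval w (inj₂ x))      ≡⟨ cong (ρ (toℕ i)) (eval-inj₂ w x) ⟩
    ρ (toℕ i) (inj₂ (actionB w ⟨$⟩ʳ x)) ≡⟨ ρ≡σ i _ ⟩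
    σ i (inj₂ (actionB w ⟨$⟩ʳ x))       ≡⟨ σ-inj₂ i (trans (cong (actB (toℕ i)) (toℕ-toPermutation (permutationB w) x))
                                                        (sym (toℕ-toPermutation (permutationB (i ∷ w)) x))) ⟩
    inj₂ (actionB (i ∷ w) ⟨$⟩ʳ x)       ∎
    where open ≡-Reasoning

  SameAction : G.Word → G.Word → Set
  SameAction w v = (∀ x → actionA w ⟨$⟩ʳ x ≡ actionA v ⟨$⟩ʳ x)
                 × (∀ x → actionB w ⟨$⟩ʳ x ≡ actionB v ⟨$⟩ʳ x)

  eval≗⇒sameAction : ∀ {w v} → (∀ x → G.eval w x ≡ G.eval v x) → SameAction w v
  eval≗⇒sameAction {w} {v} w≗v =
      (λ x → inj₁-injective (trans (sym (eval-inj₁ w x)) (trans (w≗v (inj₁ x)) (eval-inj₁ v x))))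
    , (λ x → inj₂-injective (trans (sym (eval-inj₂ w x)) (trans (w≗v (inj₂ x)) (eval-inj₂ v x))))

  sameAction⇒eval≗ : ∀ {w v} → SameAction w v → ∀ x → G.eval w x ≡ G.eval v x
  sameAction⇒eval≗ {w} {v} (sameA , _) (inj₁ x) = trans (eval-inj₁ w x) (trans (cong inj₁ (sameA x)) (sym (eval-inj₁ v x)))
  sameAction⇒eval≗ {w} {v} (_ , sameB) (inj₂ x) = trans (eval-inj₂ w x) (trans (cong inj₂ (sameB x)) (sym (eval-inj₂ v x)))


module RepresentedGroup (q : ℕ) where
  open Action q
  open Parabolics q
  open Generation q
  open Representation q

  agree⇒sameAction : ∀ {w v} → A.eval (labels w) ≈ᴬ A.eval (labels v) →
                     B.eval (labels w) ≈ᴮ B.eval (labels v) → SameAction w v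
  agree⇒sameAction {w} {v} onA onB =
      agree⇒toPermutation-≈ (permutationA w) (permutationA v) onA
    , agree⇒toPermutation-≈ (permutationB w) (permutationB v) onB

  sameAction⇒agree : ∀ {w v} → SameAction w v →
                     A.eval (labels w) ≈ᴬ A.eval (labels v) × B.eval (labels w) ≈ᴮ B.eval (labels v)
  sameAction⇒agree {w} {v} (sameA , sameB) =
      toPermutation-≈⇒agree (permutationA w) (permutationA v) sameA
    , toPermutation-≈⇒agree (permutationB w) (permutationB v) sameB

  ρ𝒢 : Fin r → Vtx r → Vtx r
  ρ𝒢 = ρs (vtx-≟ r) r (𝒢 r)

  involution : ∀ i → G.IsInvolution (ρ𝒢 i)
  involution i =
      sameAction⇒eval≗ {i ∷ i ∷ []} {[]}
        (agree⇒sameAction {i ∷ i ∷ []} {[]} (λ _ → actA-involutive l _) (λ _ → actB-involutive l _))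
    , inj₁ x₀ , moves
    where
    l = toℕ i
    x₀ : Fin (5 + q)
    x₀ = fromℕ< (≤-trans (toℕ<n i) (m≤n+m _ 2))
    moves : ρ𝒢 i (inj₁ x₀) ≢ inj₁ x₀
    moves ρx₀≡x₀ = 1+n≢n (begin
      suc l                  ≡⟨ actA-at-l l ⟨
      actA l l               ≡⟨ cong (actA l) (toℕ-fromℕ< _) ⟨
      actA l (toℕ x₀)        ≡⟨ toℕ-restrict (actA l) (actA-< (label≤ i)) x₀ ⟨
      toℕ (restrict (actA l) (actA-< (label≤ i)) x₀) ≡⟨ cong toℕ (inj₁-injective (trans (sym (ρ≡σ i (inj₁ x₀))) ρx₀≡x₀)) ⟩
      toℕ x₀                 ≡⟨ toℕ-fromℕ< _ ⟩
      l                      ∎)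
      where open ≡-Reasoning

  commute : ∀ i j → 2 ≤ ∣ toℕ i - toℕ j ∣ → ∀ x → (ρ𝒢 i ∘ ρ𝒢 j ∘ ρ𝒢 i ∘ ρ𝒢 j) x ≡ x
  commute i j far = sameAction⇒eval≗ {i ∷ j ∷ i ∷ j ∷ []} {[]}
    (agree⇒sameAction {i ∷ j ∷ i ∷ j ∷ []} {[]}
      (λ _ → ∘-involutive {actA a} {actA b} (actA-involutive a) (actA-involutive b) commuteA _)
      (λ _ → ∘-involutive {actB a} {actB b} (actB-involutive a) (actB-involutive b) commuteB _))
    where
    a = toℕ i
    b = toℕ j
    commuteA : ∀ n → actA a (actA b n) ≡ actA b (actA a n)
    commuteA n with far-apart a b far
    ... | inj₁ a+2≤b = actA-commute a+2≤b (label≤ j) n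
    ... | inj₂ b+2≤a = sym (actA-commute b+2≤a (label≤ i) n)
    commuteB : ∀ n → actB a (actB b n) ≡ actB b (actB a n)
    commuteB n with far-apart a b far
    ... | inj₁ a+2≤b = actB-commute a+2≤b n
    ... | inj₂ b+2≤a = sym (actB-commute b+2≤a n)

  fromLabels : ∀ u → All (_< r) u → G.Word
  fromLabels []      []           = []
  fromLabels (j ∷ u) (j<r ∷ u<r) = fromℕ< j<r ∷ fromLabels u u<r

  labels-fromLabels : ∀ u (u<r : All (_< r) u) → labels (fromLabels u u<r) ≡ u
  labels-fromLabels []      []           = refl
  labels-fromLabels (j ∷ u) (j<r ∷ u<r) = cong₂ _∷_ (toℕ-fromℕ< j<r) (labels-fromLabels u u<r)

  module _ {P α β} (W : WordFor P α β) where
    open WordFor W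

    toWord : G.Word
    toWord = fromLabels word (All.map (s≤s ∘ proj₂) allowed)

    toWord-agrees : A.eval (labels toWord) ≈ᴬ α × B.eval (labels toWord) ≈ᴮ β
    toWord-agrees = (λ {n} n< → trans (cong (λ u → A.eval u n) labels≡word) (onA n<))
                  , (λ {n} n< → trans (cong (λ u → B.eval u n) labels≡word) (onB n<))
      where labels≡word = labels-fromLabels word (All.map (s≤s ∘ proj₂) allowed)

    toWord-letters : ∀ {Q : Fin r → Set} → (∀ {j} (j<r : j < r) → P j → Q (fromℕ< j<r)) → All Q toWord
    toWord-letters {Q} P⇒Q = go allowed
      where
      go : ∀ {u} (Pu : All (λ j → P j × j ≤ 2 + q) u) → All Q (fromLabels u (All.map (s≤s ∘ proj₂) Pu))
      go []                = []
      go ((Pj , j≤) ∷ Pu) = P⇒Q (s≤s j≤) Pj ∷ go Pu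

  parabolic-word : ∀ (S : Subset r) {w} → All (_∈ₛ S) w →
                   ∀ {k} (k≤2+q : k ≤ 2 + q) → ¬ (fromℕ< (s≤s k≤2+q) ∈ₛ S) →
                   Parabolic k (A.eval (labels w)) (B.eval (labels w))
                   × Parabolic k (A.eval (reverse (labels w))) (B.eval (reverse (labels w)))
  parabolic-word S w∈S {k} k≤2+q k∉S =
    parabolic-eval k≤2+q avoids (parabolic-id k) , parabolic-eval k≤2+q (All-reverse avoids) (parabolic-id k)
    where
    avoids = map⁺ (All.map (λ {i} i∈S → label≤ i , λ i≡k → k∉S (subst (_∈ₛ S) (i≡k⇒i≡fromℕ< i≡k) i∈S)) w∈S)
      where i≡k⇒i≡fromℕ< = λ {i} i≡k → toℕ-injective {i = i} (trans i≡k (sym (toℕ-fromℕ< _)))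

  module Intersection (I J : Subset r) where

    P : ℕ → Set
    P j = Σ[ j<r ∈ j < r ] fromℕ< j<r ∈ₛ I ∩ J

    P? : Decidable P
    P? j with j <? r
    ... | no j≮r = no (j≮r ∘ proj₁)
    ... | yes j<r with fromℕ< j<r ∈? (I ∩ J)
    ...   | yes j∈I∩J = yes (j<r , j∈I∩J)
    ...   | no j∉I∩J  = no (j∉I∩J ∘ proj₂)

    intersection : ∀ σ → G.InGen I σ × G.InGen J σ → G.InGen (I ∩ J) σ
    intersection σ ((w , w∈I , w≗σ) , (v , v∈J , v≗σ)) =
      toWord W , toWord-letters W (λ _ → proj₂) , λ x → trans (sameAction⇒eval≗ {toWord W} {w} W≈w x) (w≗σ x)
      where
      v≈w = sameAction⇒agree {v} {w} (eval≗⇒sameAction {v} {w} λ x → trans (v≗σ x) (sym (w≗σ x)))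

      parabolic : ∀ {k} → k ≤ 2 + q → ¬ P k →
                  Parabolic k (A.eval (labels w)) (B.eval (labels w))
                  × Parabolic k (A.eval (reverse (labels w))) (B.eval (reverse (labels w)))
      parabolic k≤2+q ¬Pk with fromℕ< (s≤s k≤2+q) ∈? I
      ... | no k∉I  = parabolic-word I w∈I k≤2+q k∉I
      ... | yes k∈I =
          parabolic-resp k≤2+q (proj₁ v≈w) (proj₂ v≈w) pv
        , parabolic-resp k≤2+q (inverse-unique (permutationA v) (permutationA w) (proj₁ v≈w))
                               (inverse-unique (permutationB v) (permutationB w) (proj₂ v≈w)) pv⁻¹
        where
        pv,pv⁻¹ = parabolic-word J v∈J k≤2+q (λ k∈J → ¬Pk (s≤s k≤2+q , x∈p∩q⁺ (k∈I , k∈J)))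
        pv = proj₁ pv,pv⁻¹
        pv⁻¹ = proj₂ pv,pv⁻¹

      W = generate P P? (permutationA w) (permutationB w) parabolic
      W≈w = agree⇒sameAction {toWord W} {w} (proj₁ (toWord-agrees W)) (proj₂ (toWord-agrees W))

  string-C-group : G.IsStringCGroup
  string-C-group = involution , commute , λ I J σ →
      Intersection.intersection I J σ
    , λ (w , w∈I∩J , w≗σ) → (w , All.map (p∩q⊆p I J) w∈I∩J , w≗σ) , (w , All.map (p∩q⊆q I J) w∈I∩J , w≗σ)

  φ : G.Word → Permutation′ (5 + q) × Permutation′ r
  φ w = actionA w , actionB w

  eval-++ : ∀ w v y → G.eval (w ++ v) y ≡ G.eval w (G.eval v y)
  eval-++ []      v y = refl
  eval-++ (i ∷ w) v y = cong (ρ𝒢 i) (eval-++ w v y)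

  open GroupMorphisms (RepGroup (vtx-≟ r) r (𝒢 r)) (Sym (2 + r) ×G Sym r)

  open RawGroup (Sym (2 + r) ×G Sym r) using () renaming (_≈_ to _≈ₛ_; _∙_ to _∙ₛ_; _⁻¹ to _⁻¹ₛ)

  φ-homo : ∀ w v → φ (w ++ v) ≈ₛ (φ w ∙ₛ φ v)
  φ-homo w v = (λ x → inj₁-injective (begin
      inj₁ (actionA (w ++ v) ⟨$⟩ʳ x)            ≡⟨ eval-inj₁ (w ++ v) x ⟨
      G.eval (w ++ v) (inj₁ x)                  ≡⟨ eval-++ w v (inj₁ x) ⟩
      G.eval w (G.eval v (inj₁ x))              ≡⟨ cong (G.eval w) (eval-inj₁ v x) ⟩
      G.eval w (inj₁ (actionA v ⟨$⟩ʳ x))        ≡⟨ eval-inj₁ w _ ⟩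
      inj₁ (actionA w ⟨$⟩ʳ (actionA v ⟨$⟩ʳ x))  ∎))
    , (λ x → inj₂-injective (begin
      inj₂ (actionB (w ++ v) ⟨$⟩ʳ x)            ≡⟨ eval-inj₂ (w ++ v) x ⟨
      G.eval (w ++ v) (inj₂ x)                  ≡⟨ eval-++ w v (inj₂ x) ⟩
      G.eval w (G.eval v (inj₂ x))              ≡⟨ cong (G.eval w) (eval-inj₂ v x) ⟩
      G.eval w (inj₂ (actionB v ⟨$⟩ʳ x))        ≡⟨ eval-inj₂ w _ ⟩
      inj₂ (actionB w ⟨$⟩ʳ (actionB v ⟨$⟩ʳ x))  ∎))
    where open ≡-Reasoning

  φ-inverse : ∀ w → φ (reverse w) ≈ₛ (φ w ⁻¹ₛ)
  φ-inverse w =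
      (λ x → toℕ-injective (trans (toℕ-toPermutation (permutationA (reverse w)) x)
                                  (trans (cong (λ u → A.eval u (toℕ x)) (reverse-map toℕ w))
                                         (sym (toℕ-toPermutation⁻¹ (permutationA w) x)))))
    , (λ x → toℕ-injective (trans (toℕ-toPermutation (permutationB (reverse w)) x)
                                  (trans (cong (λ u → B.eval u (toℕ x)) (reverse-map toℕ w))
                                         (sym (toℕ-toPermutation⁻¹ (permutationB w) x)))))

  φ-surjective : ∀ πτ → ∃ λ w → ∀ {v} → (∀ x → G.eval v x ≡ G.eval w x) → φ v ≈ₛ πτ
  φ-surjective (π , τ) = toWord W , λ {v} v≗W → on-W {v} (eval≗⇒sameAction {v} {toWord W} v≗W)
    where
    W = generate (λ _ → ⊤) (λ _ → yes tt) (extend-permutationOn π) (extend-permutationOn τ)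
                 (λ _ ¬⊤ → ⊥-elim (¬⊤ tt))
    on-W : ∀ {v} → SameAction v (toWord W) → φ v ≈ₛ (π , τ)
    on-W (v≈W-A , v≈W-B) =
        (λ x → trans (v≈W-A x) (toℕ-injective (trans (toℕ-toPermutation (permutationA (toWord W)) x)
                                 (trans (proj₁ (toWord-agrees W) (toℕ<n x)) (extend-toℕ (π ⟨$⟩ʳ_) x)))))
      , (λ x → trans (v≈W-B x) (toℕ-injective (trans (toℕ-toPermutation (permutationB (toWord W)) x)
                                 (trans (proj₂ (toWord-agrees W) (toℕ<n x)) (extend-toℕ (τ ⟨$⟩ʳ_) x)))))

  isomorphism : RepGroup (vtx-≟ r) r (𝒢 r) ≅ (Sym (2 + r) ×G Sym r)
  isomorphism = φ , record
    { isGroupMonomorphism = record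
      { isGroupHomomorphism = record
        { isMonoidHomomorphism = record
          { isMagmaHomomorphism = record
            { isRelHomomorphism = record { cong = λ {w} {v} → eval≗⇒sameAction {w} {v} }
            ; homo              = φ-homo
            }
          ; ε-homo = (λ x → fromℕ<-toℕ x _) , (λ x → fromℕ<-toℕ x _)
          }
        ; ⁻¹-homo = φ-inverse
        }
      ; injective = λ {w} {v} → sameAction⇒eval≗ {w} {v}
      }
    ; surjective = φ-surjective
    }

lemma4p6 : (r : ℕ) → 3 ≤ r →
    IsCPRGraph (vtx-≟ r) r (𝒢 r)
    × (RepGroup (vtx-≟ r) r (𝒢 r) ≅ (Sym (2 + r) ×G Sym r))
lemma4p6 (suc (suc (suc q))) (s≤s (s≤s (s≤s z≤n))) = (well-formed , string-C-group) , isomorphism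
  where open Representation q using (well-formed)
        open RepresentedGroup q using (string-C-group; isomorphism)
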